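{- Let $w\in W_0$ and equip $\Sigma$ with the Weyl chamber orientation $\phi_w$. Let $u,v\in W_0$, $y=t^\mu u\in W$ with $\mu\in R^\vee$, and $x\in W$ with $x\mathbf{c}_\mathbf{f}\subseteq\mathcal{C}_{\mu,v}=\mu+\mathcal{C}_v$. Let $\gamma$ be a minimal gallery from $y\mathbf{c}_\mathbf{f}$ to $x\mathbf{c}_\mathbf{f}$ that crosses a wall $H$ of class $\alpha\in\Phi^+$. Then this crossing is $\phi_w$-positive if and only if $v$ lies on the $\partial\phi_w$-negative side of $\partial H$, i.e. if and only if $\mathcal{C}_v$ and $\mathcal{C}_w$ lie on different sides of $H_{\alpha,0}$.
   Context: Let $\Phi$ be an irreducible crystallographic root system in a Euclidean space $V$ with inner product $\langle\cdot,\cdot\rangle$, fixed positive roots $\Phi^+$ and coroot lattice $R^\vee$. Let $W_0$ be its Weyl group and $W=T\rtimes W_0$ the affine Weyl group, $T\cong R^\vee$ acting by translations; elements are written $t^\mu u$, $\mu\in R^\vee$, $u\in W_0$. The walls of the Coxeter complex $\Sigma$ of $W$ are $H_{\alpha,k}=\{z\in V:\langle z,\alpha\rangle=k\}$, $\alpha\in\Phi^+$, $k\in\mathbb{Z}$; $\alpha$ is the class of $H_{\alpha,k}$. Alcoves are closures of connected components of the complement of all walls; $\mathbf{c}_\mathbf{f}=\{z:0\le\langle z,\alpha\rangle\le1\ \forall\alpha\in\Phi^+\}$, and $x\mapsto x\mathbf{c}_\mathbf{f}$ is a bijection $W\to$ alcoves. Panels are codimension-one faces of alcoves; a panel $p$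 lies in a unique wall $H_p$. $\mathcal{C}_f=\{z:\langle z,\alpha\rangle\ge0\ \forall\alpha\in\Phi^+\}$, $\mathcal{C}_v=v\mathcal{C}_f$, and the local Weyl chamber at $\mu$ with direction $v$ is the cone $\mathcal{C}_{\mu,v}=\mu+\mathcal{C}_v$ (the intersection over $\alpha\in\Phi^+$ of the half-spaces of $H_{\alpha,\langle\mu,\alpha\rangle}$ containing the alcove $t^\mu v\mathbf{c}_\mathbf{f}$). The boundary sphere $\partial\Sigma$ is the spherical Coxeter complex of $W_0$ whose chambers are parallel classes of Weyl chambers (identified with elements of $W_0$), a wall $H$ of class $\alpha$ determines the boundary wall $\partial H$ (corresponding to $H_{\alpha,0}$), and $\partial\phi_w$ is the orientation of $\partial\Sigma$ whose positive side of each wall contains $w$. The Weyl chamber orientation $\phi_w$ of $\Sigma$: the $\phi_w$-positive side of $H_{\alpha,k}$ is $\{\langle z,\alpha\rangle\ge k\}$ if $\langle\cdot,\alpha\rangle\ge0$ on $\mathcal{C}_w$ and $\{\langle z,\alpha\rangle\le k\}$ otherwise; $\phi_w(p,\mathbf{c})=+1$ iff the alcove $\mathbf{c}$ lies on the positive side of $H_p$. A gallery is a sequence $(\mathbf{c}_0,p_1,\dots,p_n,\mathbf{c}_n)$ of alcoves and panels with $p_i\subseteq\mathbf{c}_{i-1}\cap\mathbf{c}_i$; minimal if no shorter gallery joins its ends. If $\mathbf{c}_{i-1}\ne\mathbf{c}_i$ it crosses $H_{p_i}$; the crossing is positive if $\phi(p_i,\mathbf{c}_{i-1})=+1$ and 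$\phi(p_i,\mathbf{c}_i)=-1$.
   Formalization: The Euclidean space V is taken as ℚ^n with a rational positive definite inner product, so alcoves, Weyl chambers, walls and panels are sets of points with rational coordinates. -}

module Defs where

open import Data.Nat using (ℕ; zero; suc)
open import Data.Integer using (ℤ; +_)
open import Data.Rational using (ℚ; 0ℚ; 1ℚ; _+_; _*_; -_; _-_; _≤_; _<_; _≟_; 1/_; _/_)
open import Data.Rational.Base using (≢-nonZero)
open import Data.Fin using (Fin; zero; suc; inject₁)
open import Data.Vec using (Vec; zipWith; map; replicate; lookup)
open import Data.List using (List; foldr)
open import Data.Bool using (Bool)
open import Data.Product using (Σ; ∃; _×_; _,_; proj₁; proj₂)
open import Data.Sum using (_⊎_)
open import Relation.Nullary using (¬_; yes; no)
open import Relation.Binary.PropositionalEquality using (_≡_; _≢_)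
open import Level using (0ℓ)
open import Function.Bundles using (_⇔_)

V : ℕ → Set
V n = Vec ℚ n

sumFin : ∀ {k} → (Fin k → ℚ) → ℚ
sumFin {zero}  f = 0ℚ
sumFin {suc k} f = f zero + sumFin (λ i → f (suc i))

_⊕_ : ∀ {n} → V n → V n → V n
_⊕_ = zipWith _+_

_·_ : ∀ {n} → ℚ → V n → V n
c · z = map (c *_) z

𝟘 : ∀ {n} → V n
𝟘 = replicate _ 0ℚ

vsum : ∀ {n k} → (Fin k → V n) → V n
vsum {k = zero}  f = 𝟘
vsum {k = suc k} f = f zero ⊕ vsum (λ i → f (suc i))

ℤ→ℚ : ℤ → ℚ
ℤ→ℚ k = k / 1

-- division with the (irrelevant) convention q/0 = 0; only ever used
-- with a nonzero denominator ⟨α,α⟩ > 0.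
_÷'_ : ℚ → ℚ → ℚ
p ÷' q with q ≟ 0ℚ
... | yes _  = 0ℚ
... | no q≢0 = p * (1/_ q {{≢-nonZero q≢0}})

record RootSystem (n : ℕ) : Set where
  field
    gram     : Fin n → Fin n → ℚ
  ⟨_,_⟩ : V n → V n → ℚ
  ⟨ u , v ⟩ = sumFin (λ i → sumFin (λ j → lookup u i * (gram i j * lookup v j)))

  refl : V n → V n → V n
  refl α z = z ⊕ ((- ((ℤ→ℚ (+ 2) * ⟨ z , α ⟩) ÷' ⟨ α , α ⟩)) · α)

  field
    gram-sym : ∀ i j → gram i j ≡ gram j i
    posdef   : ∀ z → z ≢ 𝟘 → 0ℚ < ⟨ z , z ⟩
    m        : ℕ
    root     : Fin m → V n
    root-inj : ∀ i j → root i ≡ root j → i ≡ j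
    nonempty : Fin m
    root≢0   : ∀ i → root i ≢ 𝟘
    spans    : ∀ z → ∃ λ (c : Fin m → ℚ) → z ≡ vsum (λ i → c i · root i)
    reflect-closed : ∀ i j → ∃ λ k → root k ≡ refl (root i) (root j)
    crystallographic : ∀ i j → ∃ λ (a : ℤ) →
                         ℤ→ℚ (+ 2) * ⟨ root j , root i ⟩ ≡ ℤ→ℚ a * ⟨ root i , root i ⟩
    reduced  : ∀ i j (c : ℚ) → root j ≡ c · root i → (c ≡ 1ℚ) ⊎ (c ≡ - 1ℚ)
    irreducible : ∀ (f : Fin m → Bool) →
                  (∀ i j → f i ≢ f j → ⟨ root i , root j ⟩ ≡ 0ℚ) →
                  ∀ i j → f i ≡ f j
    -- a regular vector ξ fixing the positive system Φ⁺ = {α : ⟨α,ξ⟩ > 0}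
    ξ         : V n
    ξ-regular : ∀ i → ⟨ root i , ξ ⟩ ≢ 0ℚ

  Positive : Fin m → Set
  Positive i = 0ℚ < ⟨ root i , ξ ⟩

  coroot : V n → V n
  coroot α = (ℤ→ℚ (+ 2) ÷' ⟨ α , α ⟩) · α

  InCorootLattice : V n → Set
  InCorootLattice μ = ∃ λ (c : Fin m → ℤ) → μ ≡ vsum (λ i → ℤ→ℚ (c i) · coroot (root i))

  -- Weyl group W₀: elements given as words s_{i₁} ⋯ s_{iₖ} in reflections
  W₀ : Set
  W₀ = List (Fin m)

  act₀ : W₀ → V n → V n
  act₀ u z = foldr (λ i y → refl (root i) y) z u

  -- affine Weyl group W = T ⋊ W₀ : elements t^μ u, μ ∈ R^∨
  W : Set
  W = Σ (V n) InCorootLattice × W₀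

  t^_[_]_ : (μ : V n) → InCorootLattice μ → W₀ → W
  t^ μ [ p ] u = (μ , p) , u

  act : W → V n → V n
  act ((μ , _) , u) z = μ ⊕ act₀ u z

  InCf : V n → Set
  InCf z = ∀ i → Positive i → 0ℚ ≤ ⟨ z , root i ⟩

  Incf : V n → Set
  Incf z = ∀ i → Positive i → (0ℚ ≤ ⟨ z , root i ⟩) × (⟨ z , root i ⟩ ≤ 1ℚ)

  InAlcove : W → V n → Set
  InAlcove x p = ∃ λ z → Incf z × p ≡ act x z

  InChamber : W₀ → V n → Set
  InChamber v p = ∃ λ z → InCf z × p ≡ act₀ v z

  InLocalChamber : V n → W₀ → V n → Set
  InLocalChamber μ v p = ∃ λ z → InCf z × p ≡ μ ⊕ act₀ v z

  Wall : Set
  Wall = Σ (Fin m) Positive × ℤ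

  cls : Wall → Fin m
  cls ((i , _) , _) = i

  InWall : Wall → V n → Set
  InWall ((i , _) , k) z = ⟨ z , root i ⟩ ≡ ℤ→ℚ k

  SameWall : Wall → Wall → Set
  SameWall ((i , _) , k) ((j , _) , l) = (i ≡ j) × (k ≡ l)

  _⊆_ : (V n → Set) → (V n → Set) → Set
  P ⊆ Q = ∀ z → P z → Q z

  SameAlcove : W → W → Set
  SameAlcove x y = (InAlcove x ⊆ InAlcove y) × (InAlcove y ⊆ InAlcove x)

  IsPanel : (V n → Set) → Set
  IsPanel p = ∃ λ (x : W) → ∃ λ (H : Wall) →
      (∀ z → p z ⇔ (InAlcove x z × InWall H z))
    × (∃ λ z → p z)
    × (∀ H' → p ⊆ InWall H' → SameWall H' H)

  record Gallery : Set₁ where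
    field
      len    : ℕ
      alc    : Fin (suc len) → W
      pan    : Fin len → V n → Set
      wall   : Fin len → Wall
      isPanel : ∀ i → IsPanel (pan i)
      inWall  : ∀ i → pan i ⊆ InWall (wall i)
      inPrev  : ∀ i → pan i ⊆ InAlcove (alc (inject₁ i))
      inNext  : ∀ i → pan i ⊆ InAlcove (alc (suc i))

    start : W
    start = alc zero

    end : W
    end = alc (Data.Fin.fromℕ len)

    Crosses : Fin len → Set
    Crosses i = ¬ SameAlcove (alc (inject₁ i)) (alc (suc i))

  open Gallery public

  Minimal : Gallery → Set₁
  Minimal γ = ∀ (γ' : Gallery) →
    SameAlcove (start γ') (start γ) → SameAlcove (end γ') (end γ) →
    Data.Nat._≤_ (len γ) (len γ')

  ChamberNonneg : W₀ → V n → Set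
  ChamberNonneg w α = ∀ z → InChamber w z → 0ℚ ≤ ⟨ z , α ⟩

  ChamberNonpos : W₀ → V n → Set
  ChamberNonpos w α = ∀ z → InChamber w z → ⟨ z , α ⟩ ≤ 0ℚ

  PosSide : W₀ → Wall → V n → Set
  PosSide w ((i , _) , k) z =
      (ChamberNonneg w (root i) → ℤ→ℚ k ≤ ⟨ z , root i ⟩)
    × (¬ ChamberNonneg w (root i) → ⟨ z , root i ⟩ ≤ ℤ→ℚ k)

  -- φ_w(p, c) = +1  iff  c lies on the φ_w-positive side of H_p
  φ+ : W₀ → Wall → W → Set
  φ+ w H c = InAlcove c ⊆ PosSide w H

  PositiveCrossing : W₀ → (γ : Gallery) → Fin (len γ) → Set
  PositiveCrossing w γ i =
    φ+ w (wall γ i) (alc γ (inject₁ i)) × ¬ φ+ w (wall γ i) (alc γ (suc i))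

  DifferentSides : W₀ → W₀ → V n → Set
  DifferentSides v w α =
      (ChamberNonneg w α × ChamberNonpos v α)
    ⊎ (ChamberNonpos w α × ChamberNonneg v α)

-- Alcoves are intersections of strips: for each positive root α there is an integer a, the level of
-- the alcove at α, with a ≤ ⟨z,α⟩ ≤ a + 1 on the alcove. A minimal gallery crosses each wall at most
-- once, since reflecting in H the alcoves between a crossing of H and a later panel in H would give
-- a shorter gallery with the same ends. So along a minimal gallery crossing H = H_{α,k} the condition
-- "level at α ≥ k" changes exactly once, at that crossing. The first alcove t^μ u c𝒻 has level ⟨μ,α⟩
-- or ⟨μ,α⟩ - 1, and the last one, inside μ + C_v, has level ≥ ⟨μ,α⟩ if α ≥ 0 on C_v and < ⟨μ,α⟩ if
-- α ≤ 0 on C_v. Hence the crossing goes towards increasing α exactly when α ≥ 0 on C_v, while the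
-- φ_w-positive side of H is the side of increasing α exactly when α ≥ 0 on C_w.

module Submission where

open import Defs
open import Algebra.Bundles using (CommutativeRing)
open import Data.Nat as ℕ using (ℕ; zero; suc)
import Data.Nat.Properties as ℕ
open import Data.Integer as ℤ using (ℤ; 1ℤ)
import Data.Integer.Properties as ℤ
import Data.Integer.Solver as ℤ-Solver
open import Data.Fin as Fin using (Fin; zero; suc; inject₁; fromℕ)
import Data.Fin.Properties as Fin
open import Data.Rational as ℚ using (ℚ; 0ℚ; 1ℚ; _+_; _*_; -_; _-_; _≤_; _<_; 1/_)
open import Data.Rational.Properties
open import Algebra.Properties.Semiring.Sum (CommutativeRing.semiring +-*-commutativeRing) using (sum; sum-cong-≗; ∑-distrib-+; ∑-comm; *-distribˡ-sum; sum-replicate-zero)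
open import Data.Rational.Literals using (fromℤ)
import Data.Rational.Unnormalised as ℚᵘ
import Data.Rational.Unnormalised.Properties as ℚᵘ
open import Data.Rational.Solver using (module +-*-Solver)
open import Data.List using ([]; _∷_; _∷ʳ_; reverse)
open import Data.List.Properties using (foldr-∷ʳ; unfold-reverse; reverse-involutive)
open import Data.Vec using (lookup)
open import Data.Vec.Properties using (lookup-map; lookup-zipWith; lookup-replicate; tabulate∘lookup; tabulate-cong; ≡-dec)
open import Data.Product using (Σ; ∃; _×_; _,_; proj₁; proj₂)
open import Data.Sum using (_⊎_; inj₁; inj₂)
open import Data.Empty using (⊥; ⊥-elim)
open import Function using (_∘_)
open import Function.Bundles using (_⇔_; mk⇔; Equivalence)
import Function.Properties.Equivalence as ⇔
open import Relation.Nullary using (¬_; yes; no; Dec)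
open import Relation.Binary.PropositionalEquality
open import Relation.Binary.Definitions using (tri<; tri≈; tri>)

open +-*-Solver

ℤ→ℚ≡fromℤ : ∀ k → ℤ→ℚ k ≡ fromℤ k
ℤ→ℚ≡fromℤ k = ↥p/↧p≡p (fromℤ k)

ℤ→ℚ-homo-+ : ∀ a b → ℤ→ℚ (a ℤ.+ b) ≡ ℤ→ℚ a + ℤ→ℚ b
ℤ→ℚ-homo-+ a b = begin
  ℤ→ℚ (a ℤ.+ b)       ≡⟨ ℤ→ℚ≡fromℤ (a ℤ.+ b) ⟩
  fromℤ (a ℤ.+ b)     ≡⟨ toℚᵘ-injective (ℚᵘ.≃-trans (ℚᵘ.*≡* denominators) (ℚᵘ.≃-sym (toℚᵘ-homo-+ (fromℤ a) (fromℤ b)))) ⟩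
  fromℤ a + fromℤ b   ≡⟨ sym (cong₂ _+_ (ℤ→ℚ≡fromℤ a) (ℤ→ℚ≡fromℤ b)) ⟩
  ℤ→ℚ a + ℤ→ℚ b       ∎
  where
  open ≡-Reasoning
  denominators : (a ℤ.+ b) ℤ.* ℤ.+ 1 ≡ (a ℤ.* ℤ.+ 1 ℤ.+ b ℤ.* ℤ.+ 1) ℤ.* ℤ.+ 1
  denominators = cong (ℤ._* ℤ.+ 1) (sym (cong₂ ℤ._+_ (ℤ.*-identityʳ a) (ℤ.*-identityʳ b)))

ℤ→ℚ-homo-* : ∀ a b → ℤ→ℚ (a ℤ.* b) ≡ ℤ→ℚ a * ℤ→ℚ b
ℤ→ℚ-homo-* a b = begin
  ℤ→ℚ (a ℤ.* b)       ≡⟨ ℤ→ℚ≡fromℤ (a ℤ.* b) ⟩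
  fromℤ (a ℤ.* b)     ≡⟨ toℚᵘ-injective (ℚᵘ.≃-sym (toℚᵘ-homo-* (fromℤ a) (fromℤ b))) ⟩
  fromℤ a * fromℤ b   ≡⟨ sym (cong₂ _*_ (ℤ→ℚ≡fromℤ a) (ℤ→ℚ≡fromℤ b)) ⟩
  ℤ→ℚ a * ℤ→ℚ b       ∎
  where open ≡-Reasoning

ℤ→ℚ-homo‿- : ∀ a → ℤ→ℚ (ℤ.- a) ≡ - ℤ→ℚ a
ℤ→ℚ-homo‿- a = begin
  ℤ→ℚ (ℤ.- a)    ≡⟨ ℤ→ℚ≡fromℤ (ℤ.- a) ⟩
  fromℤ (ℤ.- a)  ≡⟨ toℚᵘ-injective (ℚᵘ.≃-sym (toℚᵘ-homo‿- (fromℤ a))) ⟩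
  - fromℤ a      ≡⟨ cong -_ (sym (ℤ→ℚ≡fromℤ a)) ⟩
  - ℤ→ℚ a        ∎
  where open ≡-Reasoning

ℤ→ℚ-homo-sub : ∀ a b → ℤ→ℚ (a ℤ.- b) ≡ ℤ→ℚ a - ℤ→ℚ b
ℤ→ℚ-homo-sub a b = trans (ℤ→ℚ-homo-+ a (ℤ.- b)) (cong (ℤ→ℚ a +_) (ℤ→ℚ-homo‿- b))

ℤ→ℚ-suc : ∀ a → ℤ→ℚ (ℤ.suc a) ≡ ℤ→ℚ a + 1ℚ
ℤ→ℚ-suc a = trans (ℤ→ℚ-homo-+ 1ℤ a) (+-comm 1ℚ (ℤ→ℚ a))

ℤ→ℚ-pred : ∀ a → ℤ→ℚ (ℤ.pred a) ≡ ℤ→ℚ a - 1ℚ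
ℤ→ℚ-pred a = trans (ℤ→ℚ-homo-+ (ℤ.- 1ℤ) a) (+-comm (- 1ℚ) (ℤ→ℚ a))

ℤ→ℚ-suc-pred : ∀ a → ℤ→ℚ (ℤ.suc (ℤ.pred a)) ≡ ℤ→ℚ a
ℤ→ℚ-suc-pred a = cong ℤ→ℚ (ℤ.suc-pred a)

ℤ→ℚ-mono-≤ : ∀ {a b} → a ℤ.≤ b → ℤ→ℚ a ≤ ℤ→ℚ b
ℤ→ℚ-mono-≤ {a} {b} a≤b = subst₂ _≤_ (sym (ℤ→ℚ≡fromℤ a)) (sym (ℤ→ℚ≡fromℤ b))
  (toℚᵘ-cancel-≤ (ℚᵘ.*≤* (subst₂ ℤ._≤_ (sym (ℤ.*-identityʳ a)) (sym (ℤ.*-identityʳ b)) a≤b)))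

ℤ→ℚ-cancel-≤ : ∀ {a b} → ℤ→ℚ a ≤ ℤ→ℚ b → a ℤ.≤ b
ℤ→ℚ-cancel-≤ {a} {b} a≤b with toℚᵘ-mono-≤ (subst₂ _≤_ (ℤ→ℚ≡fromℤ a) (ℤ→ℚ≡fromℤ b) a≤b)
... | ℚᵘ.*≤* a≤b′ = subst₂ ℤ._≤_ (ℤ.*-identityʳ a) (ℤ.*-identityʳ b) a≤b′

ℤ→ℚ-cancel-< : ∀ {a b} → ℤ→ℚ a < ℤ→ℚ b → a ℤ.< b
ℤ→ℚ-cancel-< {a} {b} a<b with toℚᵘ-mono-< (subst₂ _<_ (ℤ→ℚ≡fromℤ a) (ℤ→ℚ≡fromℤ b) a<b)
... | ℚᵘ.*<* a<b′ = subst₂ ℤ._<_ (ℤ.*-identityʳ a) (ℤ.*-identityʳ b) a<b′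

ℤ→ℚ-injective : ∀ {a b} → ℤ→ℚ a ≡ ℤ→ℚ b → a ≡ b
ℤ→ℚ-injective a≡b = ℤ.≤-antisym (ℤ→ℚ-cancel-≤ (≤-reflexive a≡b)) (ℤ→ℚ-cancel-≤ (≤-reflexive (sym a≡b)))

<suc⇒≤ : ∀ {i j} → i ℤ.< ℤ.suc j → i ℤ.≤ j
<suc⇒≤ {i} {j} i<j+1 = subst (i ℤ.≤_) (ℤ.pred-suc j) (ℤ.i<j⇒i≤pred[j] i<j+1)

pred[k]<k : ∀ k → ℤ.pred k ℤ.< k
pred[k]<k k = ℤ.i≤pred[j]⇒i<j ℤ.≤-refl

Integral : ℚ → Set
Integral q = ∃ λ k → q ≡ ℤ→ℚ k

integral-+ : ∀ {p q} → Integral p → Integral q → Integral (p + q)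
integral-+ (a , p≡a) (b , q≡b) = a ℤ.+ b , trans (cong₂ _+_ p≡a q≡b) (sym (ℤ→ℚ-homo-+ a b))

integral-* : ∀ {p q} → Integral p → Integral q → Integral (p * q)
integral-* (a , p≡a) (b , q≡b) = a ℤ.* b , trans (cong₂ _*_ p≡a q≡b) (sym (ℤ→ℚ-homo-* a b))

integral-sumFin : ∀ {k} (f : Fin k → ℚ) → (∀ i → Integral (f i)) → Integral (sumFin f)
integral-sumFin {zero}  f f-int = ℤ.+ 0 , refl
integral-sumFin {suc k} f f-int = integral-+ (f-int zero) (integral-sumFin (λ i → f (suc i)) (λ i → f-int (suc i)))

p÷q≡p*[1÷q] : ∀ p q → p ÷' q ≡ p * (1ℚ ÷' q)
p÷q≡p*[1÷q] p q with q ≟ 0ℚ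
... | yes _   = sym (*-zeroʳ p)
... | no q≢0 = cong (p *_) (sym (*-identityˡ ((1/ q) {{ℚ.≢-nonZero q≢0}})))

÷-inverseʳ : ∀ {q} → q ≢ 0ℚ → q * (1ℚ ÷' q) ≡ 1ℚ
÷-inverseʳ {q} q≢0 with q ≟ 0ℚ
... | yes q≡0  = ⊥-elim (q≢0 q≡0)
... | no q≢0′ = trans (cong (q *_) (*-identityˡ ((1/ q) {{ℚ.≢-nonZero q≢0′}}))) (*-inverseʳ q {{ℚ.≢-nonZero q≢0′}})

1÷pos>0 : ∀ {q} → 0ℚ < q → 0ℚ < 1ℚ ÷' q
1÷pos>0 {q} q>0 with q ≟ 0ℚ
... | yes q≡0  = ⊥-elim (<-irrefl (sym q≡0) q>0)
... | no q≢0 = subst (0ℚ <_) (sym (*-identityˡ ((1/ q) {{ℚ.≢-nonZero q≢0}}))) (positive⁻¹ _ {{1/pos⇒pos q {{ℚ.positive q>0}}}})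

≢⇒<⊎> : ∀ {p q} → p ≢ q → p < q ⊎ q < p
≢⇒<⊎> {p} {q} p≢q with <-cmp p q
... | tri< p<q _ _ = inj₁ p<q
... | tri≈ _ p≡q _ = ⊥-elim (p≢q p≡q)
... | tri> _ _ q<p = inj₂ q<p

2ℚ : ℚ
2ℚ = ℤ→ℚ (ℤ.+ 2)

x+k≡l⇔x≡l-k : ∀ x k l → (x + k ≡ l) ⇔ (x ≡ l - k)
x+k≡l⇔x≡l-k x k l = mk⇔ (λ x+k≡l → trans (solve 2 (λ x k → x := x :+ k :- k) refl x k) (cong (_- k) x+k≡l))
                        (λ x≡l-k → trans (cong (_+ k) x≡l-k) (solve 2 (λ l k → l :- k :+ k := l) refl l k))

-x+k≡l⇔x≡k-l : ∀ x k l → (- x + k ≡ l) ⇔ (x ≡ k - l)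
-x+k≡l⇔x≡k-l x k l = mk⇔ (λ -x+k≡l → trans (solve 2 (λ x k → x := k :- (:- x :+ k)) refl x k) (cong (λ y → k - y) -x+k≡l))
                          (λ x≡k-l → trans (cong (λ y → - y + k) x≡k-l) (solve 2 (λ k l → :- (k :- l) :+ k := l) refl k l))

Strip : ℤ → ℚ → Set
Strip a q = ℤ→ℚ a ≤ q × q ≤ ℤ→ℚ (ℤ.suc a)

StrictStrip : ℤ → ℚ → Set
StrictStrip a q = ℤ→ℚ a < q × q < ℤ→ℚ (ℤ.suc a)

strip-unique : ∀ {a b q} → StrictStrip a q → Strip b q → a ≡ b
strip-unique {a} {b} (a<q , q<a+1) (b≤q , q≤b+1) = ℤ.≤-antisym (ℤ.≮⇒≥ b<a) (ℤ.≮⇒≥ a<b)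
  where
  b<a : ¬ b ℤ.< a
  b<a b<a = <-irrefl refl (<-≤-trans a<q (≤-trans q≤b+1 (ℤ→ℚ-mono-≤ (ℤ.i<j⇒suc[i]≤j b<a))))
  a<b : ¬ a ℤ.< b
  a<b a<b = <-irrefl refl (≤-<-trans b≤q (<-≤-trans q<a+1 (ℤ→ℚ-mono-≤ (ℤ.i<j⇒suc[i]≤j a<b))))

strips-meet : ∀ {a b q} → Strip a q → Strip b q → a ℤ.< b → q ≡ ℤ→ℚ b
strips-meet (_ , q≤a+1) (b≤q , _) a<b = ≤-antisym (≤-trans q≤a+1 (ℤ→ℚ-mono-≤ (ℤ.i<j⇒suc[i]≤j a<b))) b≤q

strip-at-integer : ∀ {a k} → Strip a (ℤ→ℚ k) → a ≡ k ⊎ a ≡ ℤ.pred k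
strip-at-integer {a} {k} (a≤k , k≤a+1) with a ℤ.≟ k
... | yes a≡k = inj₁ a≡k
... | no a≢k  = inj₂ (trans (sym (ℤ.pred-suc a)) (cong ℤ.pred (ℤ.≤-antisym (ℤ.i<j⇒suc[i]≤j (ℤ.≤∧≢⇒< (ℤ→ℚ-cancel-≤ a≤k) a≢k))
                                                                          (ℤ→ℚ-cancel-≤ k≤a+1))))

strip-+ : ∀ {a t} → 0ℚ ≤ t → t ≤ 1ℚ → Strip a (ℤ→ℚ a + t)
strip-+ {a} {t} 0≤t t≤1 = subst (_≤ ℤ→ℚ a + t) (+-identityʳ (ℤ→ℚ a)) (+-monoʳ-≤ (ℤ→ℚ a) 0≤t)
                        , subst (ℤ→ℚ a + t ≤_) (sym (ℤ→ℚ-suc a)) (+-monoʳ-≤ (ℤ→ℚ a) t≤1)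

strip-pred : ∀ {a t} → 0ℚ ≤ t → t ≤ 1ℚ → Strip (ℤ.pred a) (ℤ→ℚ a - t)
strip-pred {a} {t} 0≤t t≤1 = subst (_≤ ℤ→ℚ a - t) (sym (ℤ→ℚ-pred a)) (+-monoʳ-≤ (ℤ→ℚ a) (neg-antimono-≤ t≤1))
                           , subst (ℤ→ℚ a - t ≤_) (trans (+-identityʳ (ℤ→ℚ a)) (sym (ℤ→ℚ-suc-pred a)))
                               (+-monoʳ-≤ (ℤ→ℚ a) (neg-antimono-≤ 0≤t))

strictStrip-+ : ∀ {a t} → 0ℚ < t → t < 1ℚ → StrictStrip a (ℤ→ℚ a + t)
strictStrip-+ {a} {t} 0<t t<1 = subst (_< ℤ→ℚ a + t) (+-identityʳ (ℤ→ℚ a)) (+-monoʳ-< (ℤ→ℚ a) 0<t)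
                              , subst (ℤ→ℚ a + t <_) (sym (ℤ→ℚ-suc a)) (+-monoʳ-< (ℤ→ℚ a) t<1)

strictStrip-pred : ∀ {a t} → 0ℚ < t → t < 1ℚ → StrictStrip (ℤ.pred a) (ℤ→ℚ a - t)
strictStrip-pred {a} {t} 0<t t<1 = subst (_< ℤ→ℚ a - t) (sym (ℤ→ℚ-pred a)) (+-monoʳ-< (ℤ→ℚ a) (neg-antimono-< t<1))
                                 , subst (ℤ→ℚ a - t <_) (trans (+-identityʳ (ℤ→ℚ a)) (sym (ℤ→ℚ-suc-pred a)))
                                     (+-monoʳ-< (ℤ→ℚ a) (neg-antimono-< 0<t))

strip⇒offset : ∀ {a q} → Strip a q → 0ℚ ≤ q - ℤ→ℚ a × q - ℤ→ℚ a ≤ 1ℚ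
strip⇒offset {a} {q} (a≤q , q≤a+1) = subst (_≤ q - ℤ→ℚ a) (+-inverseʳ (ℤ→ℚ a)) (+-monoˡ-≤ (- ℤ→ℚ a) a≤q)
  , subst (q - ℤ→ℚ a ≤_) (trans (cong (_- ℤ→ℚ a) (ℤ→ℚ-suc a)) (solve 1 (λ a → a :+ con 1ℚ :- a := con 1ℚ) refl (ℤ→ℚ a)))
      (+-monoˡ-≤ (- ℤ→ℚ a) q≤a+1)

strip-pred⇒offset : ∀ {a q} → Strip (ℤ.pred a) q → 0ℚ ≤ ℤ→ℚ a - q × ℤ→ℚ a - q ≤ 1ℚ
strip-pred⇒offset {a} {q} (a-1≤q , q≤a) =
    subst (_≤ ℤ→ℚ a - q) (+-inverseʳ (ℤ→ℚ a)) (+-monoʳ-≤ (ℤ→ℚ a) (neg-antimono-≤ (subst (q ≤_) (ℤ→ℚ-suc-pred a) q≤a)))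
  , subst (ℤ→ℚ a - q ≤_) (trans (cong (λ p → ℤ→ℚ a - p) (ℤ→ℚ-pred a)) (solve 1 (λ a → a :- (a :- con 1ℚ) := con 1ℚ) refl (ℤ→ℚ a)))
      (+-monoʳ-≤ (ℤ→ℚ a) (neg-antimono-≤ a-1≤q))

strictStrip-mirror : ∀ {a t} k → StrictStrip a t → StrictStrip (ℤ.pred (k ℤ.+ k ℤ.- a)) (ℤ→ℚ k + ℤ→ℚ k - t)
strictStrip-mirror {a} {t} k (a<t , t<a+1) =
    subst (_< K + K - t) (sym lower) (+-monoʳ-< (K + K) (neg-antimono-< t<a+1))
  , subst (K + K - t <_) (sym upper) (+-monoʳ-< (K + K) (neg-antimono-< a<t))
  where
  K = ℤ→ℚ k
  A = ℤ→ℚ a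
  2k-a : ℤ→ℚ (k ℤ.+ k ℤ.- a) ≡ K + K - A
  2k-a = trans (ℤ→ℚ-homo-sub (k ℤ.+ k) a) (cong (_- A) (ℤ→ℚ-homo-+ k k))
  lower : ℤ→ℚ (ℤ.pred (k ℤ.+ k ℤ.- a)) ≡ K + K - ℤ→ℚ (ℤ.suc a)
  lower = trans (ℤ→ℚ-pred (k ℤ.+ k ℤ.- a)) (trans (cong (_- 1ℚ) 2k-a)
    (trans (solve 2 (λ k a → k :+ k :- a :- con 1ℚ := k :+ k :- (a :+ con 1ℚ)) refl K A) (cong (λ s → K + K - s) (sym (ℤ→ℚ-suc a)))))
  upper : ℤ→ℚ (ℤ.suc (ℤ.pred (k ℤ.+ k ℤ.- a))) ≡ K + K - A
  upper = trans (ℤ→ℚ-suc-pred (k ℤ.+ k ℤ.- a)) 2k-a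

sumFin≡sum : ∀ {k} (f : Fin k → ℚ) → sumFin f ≡ sum f
sumFin≡sum {zero}  f = refl
sumFin≡sum {suc k} f = cong (f zero +_) (sumFin≡sum (λ i → f (suc i)))

sumFin-cong : ∀ {k} {f g : Fin k → ℚ} → (∀ i → f i ≡ g i) → sumFin f ≡ sumFin g
sumFin-cong {f = f} {g} f≗g = trans (sumFin≡sum f) (trans (sum-cong-≗ f≗g) (sym (sumFin≡sum g)))

sumFin-distrib-+ : ∀ {k} (f g : Fin k → ℚ) → sumFin (λ i → f i + g i) ≡ sumFin f + sumFin g
sumFin-distrib-+ f g = begin
  sumFin (λ i → f i + g i)  ≡⟨ sumFin≡sum (λ i → f i + g i) ⟩
  sum (λ i → f i + g i)     ≡⟨ ∑-distrib-+ f g ⟩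
  sum f + sum g             ≡⟨ sym (cong₂ _+_ (sumFin≡sum f) (sumFin≡sum g)) ⟩
  sumFin f + sumFin g       ∎
  where open ≡-Reasoning

*-distribˡ-sumFin : ∀ {k} c (f : Fin k → ℚ) → c * sumFin f ≡ sumFin (λ i → c * f i)
*-distribˡ-sumFin c f = begin
  c * sumFin f               ≡⟨ cong (c *_) (sumFin≡sum f) ⟩
  c * sum f                  ≡⟨ *-distribˡ-sum c f ⟩
  sum (λ i → c * f i)        ≡⟨ sym (sumFin≡sum (λ i → c * f i)) ⟩
  sumFin (λ i → c * f i)     ∎
  where open ≡-Reasoning

sumFin-comm : ∀ {k l} (f : Fin k → Fin l → ℚ) →
              sumFin (λ i → sumFin (λ j → f i j)) ≡ sumFin (λ j → sumFin (λ i → f i j))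
sumFin-comm f = begin
  sumFin (λ i → sumFin (λ j → f i j))  ≡⟨ trans (sumFin-cong (λ i → sumFin≡sum (f i))) (sumFin≡sum (λ i → sum (f i))) ⟩
  sum (λ i → sum (λ j → f i j))        ≡⟨ ∑-comm f ⟩
  sum (λ j → sum (λ i → f i j))        ≡⟨ sym (trans (sumFin-cong (λ j → sumFin≡sum (λ i → f i j)))
                                                       (sumFin≡sum (λ j → sum (λ i → f i j)))) ⟩
  sumFin (λ j → sumFin (λ i → f i j))  ∎
  where open ≡-Reasoning

sumFin-zero : ∀ k → sumFin {k} (λ _ → 0ℚ) ≡ 0ℚ
sumFin-zero k = trans (sumFin≡sum {k} (λ _ → 0ℚ)) (sum-replicate-zero k)

sumFin-nonneg : ∀ {k} (f : Fin k → ℚ) → (∀ i → 0ℚ ≤ f i) → 0ℚ ≤ sumFin f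
sumFin-nonneg {zero}  f f≥0 = ≤-refl
sumFin-nonneg {suc k} f f≥0 = +-mono-≤ (f≥0 zero) (sumFin-nonneg (λ i → f (suc i)) (λ i → f≥0 (suc i)))

term≤sumFin : ∀ {k} (f : Fin k → ℚ) → (∀ i → 0ℚ ≤ f i) → ∀ i → f i ≤ sumFin f
term≤sumFin {suc k} f f≥0 zero    = subst (_≤ sumFin f) (+-identityʳ (f zero))
  (+-monoʳ-≤ (f zero) (sumFin-nonneg (λ i → f (suc i)) (λ i → f≥0 (suc i))))
term≤sumFin {suc k} f f≥0 (suc i) = subst (_≤ sumFin f) (+-identityˡ (f (suc i)))
  (+-mono-≤ (f≥0 zero) (term≤sumFin (λ i → f (suc i)) (λ i → f≥0 (suc i)) i))

single : ∀ {m} → Fin m → ℤ → Fin m → ℤ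
single zero    k zero    = k
single zero    k (suc j) = ℤ.+ 0
single (suc l) k zero    = ℤ.+ 0
single (suc l) k (suc j) = single l k j

sumFin-single : ∀ {m} (l : Fin m) k (f : Fin m → ℚ) → sumFin (λ j → ℤ→ℚ (single l k j) * f j) ≡ ℤ→ℚ k * f l
sumFin-single {suc m} zero    k f = trans (cong (ℤ→ℚ k * f zero +_)
  (trans (sumFin-cong (λ j → *-zeroˡ (f (suc j)))) (sumFin-zero m))) (+-identityʳ (ℤ→ℚ k * f zero))
sumFin-single {suc m} (suc l) k f = trans (cong (_+ sumFin (λ j → ℤ→ℚ (single l k j) * f (suc j))) (*-zeroˡ (f zero)))
  (trans (+-identityˡ _) (sumFin-single l k (λ j → f (suc j))))

V-ext : ∀ {n} {u v : V n} → (∀ i → lookup u i ≡ lookup v i) → u ≡ v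
V-ext {u = u} {v} u≗v = trans (sym (tabulate∘lookup u)) (trans (tabulate-cong u≗v) (tabulate∘lookup v))

lookup-⊕ : ∀ {n} (u v : V n) i → lookup (u ⊕ v) i ≡ lookup u i + lookup v i
lookup-⊕ u v i = lookup-zipWith _+_ i u v

lookup-· : ∀ {n} c (u : V n) i → lookup (c · u) i ≡ c * lookup u i
lookup-· c u i = lookup-map i (c *_) u

lookup-𝟘 : ∀ {n} i → lookup (𝟘 {n}) i ≡ 0ℚ
lookup-𝟘 {n} i = lookup-replicate i 0ℚ

lookup-vsum : ∀ {n k} (f : Fin k → V n) i → lookup (vsum f) i ≡ sumFin (λ j → lookup (f j) i)
lookup-vsum {k = zero}  f i = lookup-𝟘 i
lookup-vsum {k = suc k} f i = trans (lookup-⊕ (f zero) (vsum (λ j → f (suc j))) i)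
                                    (cong (lookup (f zero) i +_) (lookup-vsum (λ j → f (suc j)) i))

infix 25 -ᵛ_
-ᵛ_ : ∀ {n} → V n → V n
-ᵛ v = (- 1ℚ) · v

-ᵛ-involutive : ∀ {n} (v : V n) → -ᵛ (-ᵛ v) ≡ v
-ᵛ-involutive v = V-ext λ i → trans (lookup-· (- 1ℚ) (-ᵛ v) i) (trans (cong ((- 1ℚ) *_) (lookup-· (- 1ℚ) v i))
  (solve 1 (λ x → con (- 1ℚ) :* (con (- 1ℚ) :* x) := x) refl (lookup v i)))

1·-identity : ∀ {n} (v : V n) → 1ℚ · v ≡ v
1·-identity v = V-ext λ i → trans (lookup-· 1ℚ v i) (*-identityˡ (lookup v i))

⊕-zero· : ∀ {n} (z v : V n) → z ⊕ (0ℚ · v) ≡ z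
⊕-zero· z v = V-ext λ i → trans (lookup-⊕ z (0ℚ · v) i)
  (trans (cong (lookup z i +_) (trans (lookup-· 0ℚ v i) (*-zeroˡ (lookup v i)))) (+-identityʳ (lookup z i)))

⊕-cancel : ∀ {n} (μ z : V n) → μ ⊕ (z ⊕ -ᵛ μ) ≡ z
⊕-cancel μ z = V-ext λ i → trans (lookup-⊕ μ (z ⊕ -ᵛ μ) i)
  (trans (cong (lookup μ i +_) (trans (lookup-⊕ z (-ᵛ μ) i) (cong (lookup z i +_) (lookup-· (- 1ℚ) μ i))))
         (solve 2 (λ m x → m :+ (x :+ con (- 1ℚ) :* m) := x) refl (lookup μ i) (lookup z i)))

⊕-·-cancel : ∀ {n} (z v : V n) a → (z ⊕ (a · v)) ⊕ ((- a) · v) ≡ z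
⊕-·-cancel z v a = V-ext λ i → begin
  lookup ((z ⊕ (a · v)) ⊕ ((- a) · v)) i                ≡⟨ lookup-⊕ (z ⊕ (a · v)) ((- a) · v) i ⟩
  lookup (z ⊕ (a · v)) i + lookup ((- a) · v) i          ≡⟨ cong₂ _+_ (trans (lookup-⊕ z (a · v) i) (cong (lookup z i +_) (lookup-· a v i)))
                                                              (lookup-· (- a) v i) ⟩
  lookup z i + a * lookup v i + (- a) * lookup v i      ≡⟨ solve 3 (λ x a y → x :+ a :* y :+ (:- a) :* y := x) refl (lookup z i) a (lookup v i) ⟩
  lookup z i                                            ∎
  where open ≡-Reasoning

⊕-·-interchange : ∀ {n} (μ w v : V n) a b → (μ ⊕ (a · v)) ⊕ (w ⊕ (b · v)) ≡ (μ ⊕ w) ⊕ ((a + b) · v)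
⊕-·-interchange μ w v a b = V-ext λ i → begin
  lookup ((μ ⊕ (a · v)) ⊕ (w ⊕ (b · v))) i                      ≡⟨ lookup-⊕ (μ ⊕ (a · v)) (w ⊕ (b · v)) i ⟩
  lookup (μ ⊕ (a · v)) i + lookup (w ⊕ (b · v)) i               ≡⟨ cong₂ _+_ (trans (lookup-⊕ μ (a · v) i) (cong (lookup μ i +_) (lookup-· a v i)))
                                                                     (trans (lookup-⊕ w (b · v) i) (cong (lookup w i +_) (lookup-· b v i))) ⟩
  (lookup μ i + a * lookup v i) + (lookup w i + b * lookup v i) ≡⟨ solve 5 (λ m a w b x → (m :+ a :* x) :+ (w :+ b :* x) := (m :+ w) :+ (a :+ b) :* x)
                                                                     refl (lookup μ i) a (lookup w i) b (lookup v i) ⟩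
  (lookup μ i + lookup w i) + (a + b) * lookup v i              ≡⟨ sym (cong₂ _+_ (lookup-⊕ μ w i) (lookup-· (a + b) v i)) ⟩
  lookup (μ ⊕ w) i + lookup ((a + b) · v) i                     ≡⟨ sym (lookup-⊕ (μ ⊕ w) ((a + b) · v) i) ⟩
  lookup ((μ ⊕ w) ⊕ ((a + b) · v)) i                            ∎
  where open ≡-Reasoning

⊕-·≡𝟘⇒≡· : ∀ {n} {u v : V n} c → u ⊕ ((- c) · v) ≡ 𝟘 → u ≡ c · v
⊕-·≡𝟘⇒≡· {u = u} {v} c u-cv≡0 = V-ext λ i → begin
  lookup u i                                        ≡⟨ solve 3 (λ x c y → x := (x :+ (:- c) :* y) :+ c :* y) refl (lookup u i) c (lookup v i) ⟩
  (lookup u i + (- c) * lookup v i) + c * lookup v i ≡⟨ cong (_+ c * lookup v i) (begin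
      lookup u i + (- c) * lookup v i              ≡⟨ cong (lookup u i +_) (sym (lookup-· (- c) v i)) ⟩
      lookup u i + lookup ((- c) · v) i            ≡⟨ sym (lookup-⊕ u ((- c) · v) i) ⟩
      lookup (u ⊕ ((- c) · v)) i                   ≡⟨ cong (λ w → lookup w i) u-cv≡0 ⟩
      lookup 𝟘 i                                   ≡⟨ lookup-𝟘 i ⟩
      0ℚ                                           ∎) ⟩
  0ℚ + c * lookup v i                               ≡⟨ +-identityˡ (c * lookup v i) ⟩
  c * lookup v i                                    ≡⟨ sym (lookup-· c v i) ⟩
  lookup (c · v) i                                  ∎
  where open ≡-Reasoning

module _ {n} (R : RootSystem n) where

  open RootSystem R renaming (refl to reflect)

  -- Inner product and reflections

  private
    G : V n → Fin n → ℚ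
    G w i = sumFin (λ j → gram i j * lookup w j)

  ⟨,⟩≡ΣG : ∀ u w → ⟨ u , w ⟩ ≡ sumFin (λ i → lookup u i * G w i)
  ⟨,⟩≡ΣG u w = sumFin-cong (λ i → sym (*-distribˡ-sumFin (lookup u i) (λ j → gram i j * lookup w j)))

  ⟨,⟩-⊕ˡ : ∀ u v w → ⟨ u ⊕ v , w ⟩ ≡ ⟨ u , w ⟩ + ⟨ v , w ⟩
  ⟨,⟩-⊕ˡ u v w = begin
    ⟨ u ⊕ v , w ⟩                                              ≡⟨ ⟨,⟩≡ΣG (u ⊕ v) w ⟩
    sumFin (λ i → lookup (u ⊕ v) i * G w i)                    ≡⟨ sumFin-cong (λ i → trans (cong (_* G w i) (lookup-⊕ u v i))
                                                                    (*-distribʳ-+ (G w i) (lookup u i) (lookup v i))) ⟩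
    sumFin (λ i → lookup u i * G w i + lookup v i * G w i)     ≡⟨ sumFin-distrib-+ (λ i → lookup u i * G w i) (λ i → lookup v i * G w i) ⟩
    sumFin (λ i → lookup u i * G w i) + sumFin (λ i → lookup v i * G w i)
                                                                ≡⟨ sym (cong₂ _+_ (⟨,⟩≡ΣG u w) (⟨,⟩≡ΣG v w)) ⟩
    ⟨ u , w ⟩ + ⟨ v , w ⟩                                      ∎
    where open ≡-Reasoning

  ⟨,⟩-·ˡ : ∀ c u w → ⟨ c · u , w ⟩ ≡ c * ⟨ u , w ⟩
  ⟨,⟩-·ˡ c u w = begin
    ⟨ c · u , w ⟩                                ≡⟨ ⟨,⟩≡ΣG (c · u) w ⟩
    sumFin (λ i → lookup (c · u) i * G w i)      ≡⟨ sumFin-cong (λ i → trans (cong (_* G w i) (lookup-· c u i))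
                                                      (*-assoc c (lookup u i) (G w i))) ⟩
    sumFin (λ i → c * (lookup u i * G w i))      ≡⟨ sym (*-distribˡ-sumFin c (λ i → lookup u i * G w i)) ⟩
    c * sumFin (λ i → lookup u i * G w i)        ≡⟨ cong (c *_) (sym (⟨,⟩≡ΣG u w)) ⟩
    c * ⟨ u , w ⟩                                ∎
    where open ≡-Reasoning

  ⟨,⟩-comm : ∀ u v → ⟨ u , v ⟩ ≡ ⟨ v , u ⟩
  ⟨,⟩-comm u v = trans (sumFin-comm (λ i j → lookup u i * (gram i j * lookup v j)))
    (sumFin-cong λ j → sumFin-cong λ i → trans (cong (λ g → lookup u i * (g * lookup v j)) (gram-sym i j))
      (solve 3 (λ a g b → a :* (g :* b) := b :* (g :* a)) refl (lookup u i) (gram j i) (lookup v j)))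

  ⟨,⟩-·ʳ : ∀ c u w → ⟨ w , c · u ⟩ ≡ c * ⟨ w , u ⟩
  ⟨,⟩-·ʳ c u w = trans (⟨,⟩-comm w (c · u)) (trans (⟨,⟩-·ˡ c u w) (cong (c *_) (⟨,⟩-comm u w)))

  ⟨,⟩-negˡ : ∀ u w → ⟨ -ᵛ u , w ⟩ ≡ - ⟨ u , w ⟩
  ⟨,⟩-negˡ u w = trans (⟨,⟩-·ˡ (- 1ℚ) u w) (solve 1 (λ x → con (- 1ℚ) :* x := :- x) refl ⟨ u , w ⟩)

  ⟨,⟩-negʳ : ∀ u w → ⟨ w , -ᵛ u ⟩ ≡ - ⟨ w , u ⟩
  ⟨,⟩-negʳ u w = trans (⟨,⟩-comm w (-ᵛ u)) (trans (⟨,⟩-negˡ u w) (cong -_ (⟨,⟩-comm u w)))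

  ⟨,⟩-vsumˡ : ∀ {k} (f : Fin k → V n) w → ⟨ vsum f , w ⟩ ≡ sumFin (λ j → ⟨ f j , w ⟩)
  ⟨,⟩-vsumˡ {zero}  f w = trans (⟨,⟩≡ΣG 𝟘 w) (trans (sumFin-cong (λ i → trans (cong (_* G w i) (lookup-𝟘 i)) (*-zeroˡ (G w i))))
                                                    (sumFin-zero n))
  ⟨,⟩-vsumˡ {suc k} f w = trans (⟨,⟩-⊕ˡ (f zero) (vsum (λ j → f (suc j))) w)
                                 (cong (⟨ f zero , w ⟩ +_) (⟨,⟩-vsumˡ (λ j → f (suc j)) w))

  ⟨,coroot⟩ : ∀ z α → ⟨ z , coroot α ⟩ ≡ (2ℚ ÷' ⟨ α , α ⟩) * ⟨ z , α ⟩
  ⟨,coroot⟩ z α = ⟨,⟩-·ʳ (2ℚ ÷' ⟨ α , α ⟩) α z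

  reflect-coeff : ∀ α z → (2ℚ * ⟨ z , α ⟩) ÷' ⟨ α , α ⟩ ≡ ⟨ z , coroot α ⟩
  reflect-coeff α z = begin
    (2ℚ * ⟨ z , α ⟩) ÷' ⟨ α , α ⟩        ≡⟨ p÷q≡p*[1÷q] (2ℚ * ⟨ z , α ⟩) ⟨ α , α ⟩ ⟩
    2ℚ * ⟨ z , α ⟩ * (1ℚ ÷' ⟨ α , α ⟩)   ≡⟨ solve 3 (λ t x i → t :* x :* i := t :* i :* x) refl 2ℚ ⟨ z , α ⟩ (1ℚ ÷' ⟨ α , α ⟩) ⟩
    2ℚ * (1ℚ ÷' ⟨ α , α ⟩) * ⟨ z , α ⟩   ≡⟨ cong (_* ⟨ z , α ⟩) (sym (p÷q≡p*[1÷q] 2ℚ ⟨ α , α ⟩)) ⟩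
    (2ℚ ÷' ⟨ α , α ⟩) * ⟨ z , α ⟩        ≡⟨ sym (⟨,coroot⟩ z α) ⟩
    ⟨ z , coroot α ⟩                      ∎
    where open ≡-Reasoning

  lookup-reflect : ∀ α z i → lookup (reflect α z) i ≡ lookup z i - ⟨ z , coroot α ⟩ * lookup α i
  lookup-reflect α z i = begin
    lookup (reflect α z) i                          ≡⟨ lookup-⊕ z ((- c) · α) i ⟩
    lookup z i + lookup ((- c) · α) i               ≡⟨ cong (lookup z i +_) (lookup-· (- c) α i) ⟩
    lookup z i + (- c) * lookup α i                 ≡⟨ cong (λ c → lookup z i + (- c) * lookup α i) (reflect-coeff α z) ⟩
    lookup z i + (- ⟨ z , coroot α ⟩) * lookup α i  ≡⟨ solve 3 (λ x c a → x :+ (:- c) :* a := x :- c :* a) refl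
                                                         (lookup z i) ⟨ z , coroot α ⟩ (lookup α i) ⟩
    lookup z i - ⟨ z , coroot α ⟩ * lookup α i      ∎
    where
    open ≡-Reasoning
    c = (2ℚ * ⟨ z , α ⟩) ÷' ⟨ α , α ⟩

  ⟨,⟩-reflectˡ : ∀ α z β → ⟨ reflect α z , β ⟩ ≡ ⟨ z , β ⟩ - ⟨ z , coroot α ⟩ * ⟨ α , β ⟩
  ⟨,⟩-reflectˡ α z β = begin
    ⟨ reflect α z , β ⟩                           ≡⟨ ⟨,⟩-⊕ˡ z ((- c) · α) β ⟩
    ⟨ z , β ⟩ + ⟨ (- c) · α , β ⟩                 ≡⟨ cong (⟨ z , β ⟩ +_) (⟨,⟩-·ˡ (- c) α β) ⟩
    ⟨ z , β ⟩ + (- c) * ⟨ α , β ⟩                 ≡⟨ cong (λ c → ⟨ z , β ⟩ + (- c) * ⟨ α , β ⟩) (reflect-coeff α z) ⟩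
    ⟨ z , β ⟩ + (- ⟨ z , coroot α ⟩) * ⟨ α , β ⟩  ≡⟨ solve 3 (λ x c a → x :+ (:- c) :* a := x :- c :* a) refl
                                                       ⟨ z , β ⟩ ⟨ z , coroot α ⟩ ⟨ α , β ⟩ ⟩
    ⟨ z , β ⟩ - ⟨ z , coroot α ⟩ * ⟨ α , β ⟩      ∎
    where
    open ≡-Reasoning
    c = (2ℚ * ⟨ z , α ⟩) ÷' ⟨ α , α ⟩

  ⟨α,α∨⟩≡2 : ∀ {α} → ⟨ α , α ⟩ ≢ 0ℚ → ⟨ α , coroot α ⟩ ≡ 2ℚ
  ⟨α,α∨⟩≡2 {α} α≢0 = begin
    ⟨ α , coroot α ⟩                      ≡⟨ ⟨,coroot⟩ α α ⟩
    (2ℚ ÷' ⟨ α , α ⟩) * ⟨ α , α ⟩          ≡⟨ cong (_* ⟨ α , α ⟩) (p÷q≡p*[1÷q] 2ℚ ⟨ α , α ⟩) ⟩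
    2ℚ * (1ℚ ÷' ⟨ α , α ⟩) * ⟨ α , α ⟩     ≡⟨ solve 3 (λ t i a → t :* i :* a := t :* (a :* i)) refl 2ℚ (1ℚ ÷' ⟨ α , α ⟩) ⟨ α , α ⟩ ⟩
    2ℚ * (⟨ α , α ⟩ * (1ℚ ÷' ⟨ α , α ⟩))   ≡⟨ cong (2ℚ *_) (÷-inverseʳ α≢0) ⟩
    2ℚ * 1ℚ                               ≡⟨ *-identityʳ 2ℚ ⟩
    2ℚ                                    ∎
    where open ≡-Reasoning

  reflect-adjoint : ∀ α z β → ⟨ reflect α z , β ⟩ ≡ ⟨ z , reflect α β ⟩
  reflect-adjoint α z β = begin
    ⟨ reflect α z , β ⟩                          ≡⟨ ⟨,⟩-reflectˡ α z β ⟩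
    ⟨ z , β ⟩ - ⟨ z , coroot α ⟩ * ⟨ α , β ⟩      ≡⟨ cong₂ (λ a b → ⟨ z , β ⟩ - a * b) (⟨,coroot⟩ z α) (⟨,⟩-comm α β) ⟩
    ⟨ z , β ⟩ - c * ⟨ z , α ⟩ * ⟨ β , α ⟩        ≡⟨ solve 4 (λ x c a b → x :- c :* a :* b := x :- c :* b :* a) refl ⟨ z , β ⟩ c ⟨ z , α ⟩ ⟨ β , α ⟩ ⟩
    ⟨ z , β ⟩ - c * ⟨ β , α ⟩ * ⟨ z , α ⟩        ≡⟨ cong₂ (λ a b → a - b * ⟨ z , α ⟩) (⟨,⟩-comm z β) (sym (⟨,coroot⟩ β α)) ⟩
    ⟨ β , z ⟩ - ⟨ β , coroot α ⟩ * ⟨ z , α ⟩      ≡⟨ cong (λ a → ⟨ β , z ⟩ - ⟨ β , coroot α ⟩ * a) (⟨,⟩-comm z α) ⟩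
    ⟨ β , z ⟩ - ⟨ β , coroot α ⟩ * ⟨ α , z ⟩      ≡⟨ sym (⟨,⟩-reflectˡ α β z) ⟩
    ⟨ reflect α β , z ⟩                          ≡⟨ ⟨,⟩-comm (reflect α β) z ⟩
    ⟨ z , reflect α β ⟩                          ∎
    where
    open ≡-Reasoning
    c = 2ℚ ÷' ⟨ α , α ⟩

  reflect-involutive : ∀ {α} → ⟨ α , α ⟩ ≢ 0ℚ → ∀ z → reflect α (reflect α z) ≡ z
  reflect-involutive {α} α≢0 z = V-ext λ i → begin
    lookup (reflect α (reflect α z)) i                              ≡⟨ lookup-reflect α (reflect α z) i ⟩
    lookup (reflect α z) i - ⟨ reflect α z , coroot α ⟩ * lookup α i  ≡⟨ cong₂ (λ a b → a - b * lookup α i) (lookup-reflect α z i)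
                                                                         (trans (⟨,⟩-reflectˡ α z (coroot α)) (cong (λ t → c - c * t) (⟨α,α∨⟩≡2 {α} α≢0))) ⟩
    lookup z i - c * lookup α i - (c - c * 2ℚ) * lookup α i         ≡⟨ solve 3 (λ x c a → x :- c :* a :- (c :- c :* con 2ℚ) :* a := x) refl (lookup z i) c (lookup α i) ⟩
    lookup z i                                                      ∎
    where
    open ≡-Reasoning
    c = ⟨ z , coroot α ⟩

  reflect-self : ∀ {α} → ⟨ α , α ⟩ ≢ 0ℚ → reflect α α ≡ -ᵛ α
  reflect-self {α} α≢0 = V-ext λ i → begin
    lookup (reflect α α) i                    ≡⟨ lookup-reflect α α i ⟩
    lookup α i - ⟨ α , coroot α ⟩ * lookup α i ≡⟨ cong (λ t → lookup α i - t * lookup α i) (⟨α,α∨⟩≡2 {α} α≢0) ⟩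
    lookup α i - 2ℚ * lookup α i              ≡⟨ solve 1 (λ a → a :- con 2ℚ :* a := con (- 1ℚ) :* a) refl (lookup α i) ⟩
    (- 1ℚ) * lookup α i                       ≡⟨ sym (lookup-· (- 1ℚ) α i) ⟩
    lookup (-ᵛ α) i                           ∎
    where open ≡-Reasoning

  reflect-· : ∀ α c u → reflect α (c · u) ≡ c · reflect α u
  reflect-· α c u = V-ext λ i → begin
    lookup (reflect α (c · u)) i                           ≡⟨ lookup-reflect α (c · u) i ⟩
    lookup (c · u) i - ⟨ c · u , coroot α ⟩ * lookup α i   ≡⟨ cong₂ (λ a b → a - b * lookup α i) (lookup-· c u i) (⟨,⟩-·ˡ c u (coroot α)) ⟩
    c * lookup u i - c * ⟨ u , coroot α ⟩ * lookup α i     ≡⟨ solve 4 (λ c x d a → c :* x :- c :* d :* a := c :* (x :- d :* a)) refl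
                                                                c (lookup u i) ⟨ u , coroot α ⟩ (lookup α i) ⟩
    c * (lookup u i - ⟨ u , coroot α ⟩ * lookup α i)       ≡⟨ cong (c *_) (sym (lookup-reflect α u i)) ⟩
    c * lookup (reflect α u) i                             ≡⟨ sym (lookup-· c (reflect α u) i) ⟩
    lookup (c · reflect α u) i                             ∎
    where open ≡-Reasoning

  reflect-via-coroot : ∀ α z → reflect α z ≡ z ⊕ ((- ⟨ z , α ⟩) · coroot α)
  reflect-via-coroot α z = V-ext λ i → begin
    lookup (reflect α z) i                                ≡⟨ lookup-reflect α z i ⟩
    lookup z i - ⟨ z , coroot α ⟩ * lookup α i            ≡⟨ cong (λ t → lookup z i - t * lookup α i) (⟨,coroot⟩ z α) ⟩
    lookup z i - c * ⟨ z , α ⟩ * lookup α i               ≡⟨ solve 4 (λ x c b a → x :- c :* b :* a := x :+ (:- b) :* (c :* a)) refl (lookup z i) c ⟨ z , α ⟩ (lookup α i) ⟩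
    lookup z i + (- ⟨ z , α ⟩) * (c * lookup α i)         ≡⟨ cong (λ t → lookup z i + (- ⟨ z , α ⟩) * t) (sym (lookup-· c α i)) ⟩
    lookup z i + (- ⟨ z , α ⟩) * lookup (coroot α) i      ≡⟨ cong (lookup z i +_) (sym (lookup-· (- ⟨ z , α ⟩) (coroot α) i)) ⟩
    lookup z i + lookup ((- ⟨ z , α ⟩) · coroot α) i      ≡⟨ sym (lookup-⊕ z _ i) ⟩
    lookup (z ⊕ ((- ⟨ z , α ⟩) · coroot α)) i               ∎
    where
    open ≡-Reasoning
    c = 2ℚ ÷' ⟨ α , α ⟩

  -- Roots, the Weyl group and the coroot lattice

  ⟨root,root⟩≢0 : ∀ i → ⟨ root i , root i ⟩ ≢ 0ℚ
  ⟨root,root⟩≢0 i ⟨α,α⟩≡0 = <-irrefl (sym ⟨α,α⟩≡0) (posdef (root i) (root≢0 i))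

  act₀-reverse : ∀ u z → act₀ (reverse u) (act₀ u z) ≡ z
  act₀-reverse []      z = refl
  act₀-reverse (i ∷ u) z = begin
    act₀ (reverse (i ∷ u)) (reflect (root i) (act₀ u z))   ≡⟨ cong (λ l → act₀ l (reflect (root i) (act₀ u z))) (unfold-reverse i u) ⟩
    act₀ (reverse u ∷ʳ i) (reflect (root i) (act₀ u z))    ≡⟨ foldr-∷ʳ (λ j → reflect (root j)) _ i (reverse u) ⟩
    act₀ (reverse u) (reflect (root i) (reflect (root i) (act₀ u z)))
                                                           ≡⟨ cong (act₀ (reverse u)) (reflect-involutive (⟨root,root⟩≢0 i) (act₀ u z)) ⟩
    act₀ (reverse u) (act₀ u z)                            ≡⟨ act₀-reverse u z ⟩
    z                                                      ∎
    where open ≡-Reasoning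

  act₀-reverseˡ : ∀ u z → act₀ u (act₀ (reverse u) z) ≡ z
  act₀-reverseˡ u z = subst (λ l → act₀ l (act₀ (reverse u) z) ≡ z) (reverse-involutive u) (act₀-reverse (reverse u) z)

  act₀-adjoint : ∀ u z β → ⟨ act₀ u z , β ⟩ ≡ ⟨ z , act₀ (reverse u) β ⟩
  act₀-adjoint []      z β = refl
  act₀-adjoint (i ∷ u) z β = begin
    ⟨ reflect (root i) (act₀ u z) , β ⟩              ≡⟨ reflect-adjoint (root i) (act₀ u z) β ⟩
    ⟨ act₀ u z , reflect (root i) β ⟩                ≡⟨ act₀-adjoint u z (reflect (root i) β) ⟩
    ⟨ z , act₀ (reverse u) (reflect (root i) β) ⟩    ≡⟨ cong ⟨ z ,_⟩ (sym (foldr-∷ʳ (λ j → reflect (root j)) β i (reverse u))) ⟩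
    ⟨ z , act₀ (reverse u ∷ʳ i) β ⟩                  ≡⟨ cong (λ l → ⟨ z , act₀ l β ⟩) (sym (unfold-reverse i u)) ⟩
    ⟨ z , act₀ (reverse (i ∷ u)) β ⟩                 ∎
    where open ≡-Reasoning

  act₀-reverse-≡ : ∀ u {β γ} → act₀ u β ≡ γ → act₀ (reverse u) γ ≡ β
  act₀-reverse-≡ u {β} uβ≡γ = trans (cong (act₀ (reverse u)) (sym uβ≡γ)) (act₀-reverse u β)

  act₀-· : ∀ u c z → act₀ u (c · z) ≡ c · act₀ u z
  act₀-· []      c z = refl
  act₀-· (i ∷ u) c z = trans (cong (reflect (root i)) (act₀-· u c z)) (reflect-· (root i) c (act₀ u z))

  act₀-root : ∀ u j → ∃ λ k → act₀ u (root j) ≡ root k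
  act₀-root []      j = j , refl
  act₀-root (i ∷ u) j with act₀-root u j
  ... | k , uj≡k = proj₁ (reflect-closed i k) , trans (cong (reflect (root i)) uj≡k) (sym (proj₂ (reflect-closed i k)))

  -root-is-root : ∀ j → ∃ λ k → root k ≡ -ᵛ root j
  -root-is-root j = proj₁ (reflect-closed j j) , trans (proj₂ (reflect-closed j j)) (reflect-self (⟨root,root⟩≢0 j))

  positive≢-positive : ∀ {j k} → Positive j → Positive k → root j ≢ -ᵛ root k
  positive≢-positive {j} {k} j>0 k>0 j≡-k = <-asym j>0 (subst (_< 0ℚ) (sym (trans (cong ⟨_, ξ ⟩ j≡-k) (⟨,⟩-negˡ (root k) ξ)))
    (neg-antimono-< k>0))

  data SignedRoot (v : V n) : Set where
    +root : ∀ {j} → Positive j → v ≡ root j → SignedRoot v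
    -root : ∀ {j} → Positive j → v ≡ -ᵛ root j → SignedRoot v

  root-signed : ∀ j → SignedRoot (root j)
  root-signed j with ≢⇒<⊎> (ξ-regular j)
  ... | inj₂ j>0 = +root j>0 refl
  ... | inj₁ j<0 = -root k>0 (trans (sym (-ᵛ-involutive (root j))) (cong -ᵛ_ (sym k≡-j)))
    where
    k = proj₁ (-root-is-root j)
    k≡-j = proj₂ (-root-is-root j)
    k>0 : Positive k
    k>0 = subst (0ℚ <_) (sym (trans (cong ⟨_, ξ ⟩ k≡-j) (⟨,⟩-negˡ (root j) ξ))) (neg-antimono-< j<0)

  act₀-signed : ∀ u j → SignedRoot (act₀ u (root j))
  act₀-signed u j = subst SignedRoot (sym (proj₂ (act₀-root u j))) (root-signed (proj₁ (act₀-root u j)))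

  ⟨root,coroot⟩-integral : ∀ j i → Integral ⟨ root j , coroot (root i) ⟩
  ⟨root,coroot⟩-integral j i with crystallographic i j
  ... | a , 2⟨β,α⟩≡a⟨α,α⟩ = a , (begin
    ⟨ β , coroot α ⟩                  ≡⟨ ⟨,coroot⟩ β α ⟩
    (2ℚ ÷' ⟨ α , α ⟩) * ⟨ β , α ⟩     ≡⟨ cong (_* ⟨ β , α ⟩) (p÷q≡p*[1÷q] 2ℚ ⟨ α , α ⟩) ⟩
    2ℚ * I * ⟨ β , α ⟩                ≡⟨ solve 3 (λ t i b → t :* i :* b := i :* (t :* b)) refl 2ℚ I ⟨ β , α ⟩ ⟩
    I * (2ℚ * ⟨ β , α ⟩)              ≡⟨ cong (I *_) 2⟨β,α⟩≡a⟨α,α⟩ ⟩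
    I * (ℤ→ℚ a * ⟨ α , α ⟩)           ≡⟨ solve 3 (λ i a n → i :* (a :* n) := a :* (n :* i)) refl I (ℤ→ℚ a) ⟨ α , α ⟩ ⟩
    ℤ→ℚ a * (⟨ α , α ⟩ * I)           ≡⟨ cong (ℤ→ℚ a *_) (÷-inverseʳ (⟨root,root⟩≢0 i)) ⟩
    ℤ→ℚ a * 1ℚ                        ≡⟨ *-identityʳ (ℤ→ℚ a) ⟩
    ℤ→ℚ a                             ∎)
    where
    open ≡-Reasoning
    α = root i
    β = root j
    I = 1ℚ ÷' ⟨ α , α ⟩

  lattice-integral : ∀ {μ} → InCorootLattice μ → ∀ i → Integral ⟨ μ , root i ⟩
  lattice-integral {μ} (c , μ≡Σ) i = proj₁ Σ-integral , trans ⟨μ,α⟩≡Σ (proj₂ Σ-integral)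
    where
    Σ-integral : Integral (sumFin (λ j → ℤ→ℚ (c j) * ⟨ root i , coroot (root j) ⟩))
    Σ-integral = integral-sumFin (λ j → ℤ→ℚ (c j) * ⟨ root i , coroot (root j) ⟩)
                   (λ j → integral-* (c j , refl) (⟨root,coroot⟩-integral i j))
    ⟨μ,α⟩≡Σ : ⟨ μ , root i ⟩ ≡ sumFin (λ j → ℤ→ℚ (c j) * ⟨ root i , coroot (root j) ⟩)
    ⟨μ,α⟩≡Σ = begin
      ⟨ μ , root i ⟩                                                    ≡⟨ cong ⟨_, root i ⟩ μ≡Σ ⟩
      ⟨ vsum (λ j → ℤ→ℚ (c j) · coroot (root j)) , root i ⟩             ≡⟨ ⟨,⟩-vsumˡ (λ j → ℤ→ℚ (c j) · coroot (root j)) (root i) ⟩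
      sumFin (λ j → ⟨ ℤ→ℚ (c j) · coroot (root j) , root i ⟩)           ≡⟨ sumFin-cong (λ j → trans (⟨,⟩-·ˡ (ℤ→ℚ (c j)) (coroot (root j)) (root i))
                                                                             (cong (ℤ→ℚ (c j) *_) (⟨,⟩-comm (coroot (root j)) (root i)))) ⟩
      sumFin (λ j → ℤ→ℚ (c j) * ⟨ root i , coroot (root j) ⟩)           ∎
      where open ≡-Reasoning

  private
    corootCombination : (Fin m → ℤ) → V n
    corootCombination c = vsum (λ j → ℤ→ℚ (c j) · coroot (root j))

    lookup-corootCombination : ∀ c i → lookup (corootCombination c) i ≡ sumFin (λ j → ℤ→ℚ (c j) * lookup (coroot (root j)) i)
    lookup-corootCombination c i = trans (lookup-vsum (λ j → ℤ→ℚ (c j) · coroot (root j)) i)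
                                         (sumFin-cong (λ j → lookup-· (ℤ→ℚ (c j)) (coroot (root j)) i))

  lattice-⊕ : ∀ {a b} → InCorootLattice a → InCorootLattice b → InCorootLattice (a ⊕ b)
  lattice-⊕ {a} {b} (c , a≡) (d , b≡) = (λ j → c j ℤ.+ d j) , V-ext pointwise
    where
    pointwise : ∀ i → lookup (a ⊕ b) i ≡ lookup (corootCombination (λ j → c j ℤ.+ d j)) i
    pointwise i = begin
      lookup (a ⊕ b) i                                  ≡⟨ lookup-⊕ a b i ⟩
      lookup a i + lookup b i                           ≡⟨ cong₂ (λ u v → lookup u i + lookup v i) a≡ b≡ ⟩
      lookup (corootCombination c) i + lookup (corootCombination d) i
                                                        ≡⟨ cong₂ _+_ (lookup-corootCombination c i) (lookup-corootCombination d i) ⟩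
      sumFin (λ j → ℤ→ℚ (c j) * x j) + sumFin (λ j → ℤ→ℚ (d j) * x j)
                                                        ≡⟨ sym (sumFin-distrib-+ (λ j → ℤ→ℚ (c j) * x j) (λ j → ℤ→ℚ (d j) * x j)) ⟩
      sumFin (λ j → ℤ→ℚ (c j) * x j + ℤ→ℚ (d j) * x j)  ≡⟨ sumFin-cong (λ j → trans (sym (*-distribʳ-+ (x j) (ℤ→ℚ (c j)) (ℤ→ℚ (d j))))
                                                             (cong (_* x j) (sym (ℤ→ℚ-homo-+ (c j) (d j))))) ⟩
      sumFin (λ j → ℤ→ℚ (c j ℤ.+ d j) * x j)            ≡⟨ sym (lookup-corootCombination (λ j → c j ℤ.+ d j) i) ⟩
      lookup (corootCombination (λ j → c j ℤ.+ d j)) i  ∎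
      where
      open ≡-Reasoning
      x : Fin m → ℚ
      x j = lookup (coroot (root j)) i

  lattice-coroot : ∀ l k → InCorootLattice (ℤ→ℚ k · coroot (root l))
  lattice-coroot l k = single l k , V-ext λ i →
    trans (lookup-· (ℤ→ℚ k) (coroot (root l)) i)
          (sym (trans (lookup-corootCombination (single l k) i) (sumFin-single l k (λ j → lookup (coroot (root j)) i))))

  ξ-bound : ℚ
  ξ-bound = sumFin (λ i → ℚ.∣ ⟨ root i , ξ ⟩ ∣)

  ξ₀ : V n
  ξ₀ = (1ℚ ÷' (1ℚ + ξ-bound)) · ξ

  ξ₀-interior : ∀ i → Positive i → 0ℚ < ⟨ ξ₀ , root i ⟩ × ⟨ ξ₀ , root i ⟩ < 1ℚ
  ξ₀-interior i i>0 = subst (0ℚ <_) (sym ⟨ξ₀,α⟩≡tx) (subst (_< t * x) (*-zeroʳ t) (*-monoʳ-<-pos t {{ℚ.positive t>0}} i>0))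
                    , subst (_< 1ℚ) (sym ⟨ξ₀,α⟩≡tx) (subst (t * x <_) t[1+B]≡1 (*-monoʳ-<-pos t {{ℚ.positive t>0}} x<1+B))
    where
    B = ξ-bound
    t = 1ℚ ÷' (1ℚ + B)
    x = ⟨ root i , ξ ⟩
    ⟨ξ₀,α⟩≡tx : ⟨ ξ₀ , root i ⟩ ≡ t * x
    ⟨ξ₀,α⟩≡tx = trans (⟨,⟩-·ˡ t ξ (root i)) (cong (t *_) (⟨,⟩-comm ξ (root i)))
    B≥0 : 0ℚ ≤ B
    B≥0 = sumFin-nonneg (λ j → ℚ.∣ ⟨ root j , ξ ⟩ ∣) (λ j → 0≤∣p∣ ⟨ root j , ξ ⟩)
    1+B>0 : 0ℚ < 1ℚ + B
    1+B>0 = <-≤-trans (positive⁻¹ 1ℚ) (subst (_≤ 1ℚ + B) (+-identityʳ 1ℚ) (+-monoʳ-≤ 1ℚ B≥0))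
    t>0 : 0ℚ < t
    t>0 = 1÷pos>0 1+B>0
    t[1+B]≡1 : t * (1ℚ + B) ≡ 1ℚ
    t[1+B]≡1 = trans (*-comm t (1ℚ + B)) (÷-inverseʳ (λ 1+B≡0 → <-irrefl (sym 1+B≡0) 1+B>0))
    x<1+B : x < 1ℚ + B
    x<1+B = ≤-<-trans (subst (_≤ B) (0≤p⇒∣p∣≡p (<⇒≤ i>0))
                               (term≤sumFin (λ j → ℚ.∣ ⟨ root j , ξ ⟩ ∣) (λ j → 0≤∣p∣ ⟨ root j , ξ ⟩) i))
                      (subst (_< 1ℚ + B) (+-identityˡ B) (+-monoˡ-< B (positive⁻¹ 1ℚ)))

  ξ₀∈c𝒻 : Incf ξ₀
  ξ₀∈c𝒻 i i>0 = <⇒≤ (proj₁ (ξ₀-interior i i>0)) , <⇒≤ (proj₂ (ξ₀-interior i i>0))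

  ξ₀∈C𝒻 : InCf ξ₀
  ξ₀∈C𝒻 i i>0 = proj₁ (ξ₀∈c𝒻 i i>0)

  StrictlyNonneg StrictlyNonpos : W₀ → V n → Set
  StrictlyNonneg v α = ChamberNonneg v α × ¬ ChamberNonpos v α
  StrictlyNonpos v α = ChamberNonpos v α × ¬ ChamberNonneg v α

  chamber-side : ∀ v i → StrictlyNonneg v (root i) ⊎ StrictlyNonpos v (root i)
  chamber-side v i with act₀-signed (reverse v) i
  ... | +root {j} j>0 e = inj₁ ( (λ { _ (z , z∈C , refl) → subst (0ℚ ≤_) (sym (pairing z)) (z∈C j j>0) })
                               , λ nonpos → <-irrefl refl (<-≤-trans (subst (0ℚ <_) (sym (pairing ξ₀)) (proj₁ (ξ₀-interior j j>0)))
                                                                    (nonpos (act₀ v ξ₀) (ξ₀ , ξ₀∈C𝒻 , refl))) )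
    where
    pairing : ∀ z → ⟨ act₀ v z , root i ⟩ ≡ ⟨ z , root j ⟩
    pairing z = trans (act₀-adjoint v z (root i)) (cong ⟨ z ,_⟩ e)
  ... | -root {j} j>0 e = inj₂ ( (λ { _ (z , z∈C , refl) → subst (_≤ 0ℚ) (sym (pairing z)) (neg-antimono-≤ (z∈C j j>0)) })
                               , λ nonneg → <-irrefl refl (<-≤-trans (subst (_< 0ℚ) (sym (pairing ξ₀)) (neg-antimono-< (proj₁ (ξ₀-interior j j>0))))
                                                                    (nonneg (act₀ v ξ₀) (ξ₀ , ξ₀∈C𝒻 , refl))) )
    where
    pairing : ∀ z → ⟨ act₀ v z , root i ⟩ ≡ - ⟨ z , root j ⟩
    pairing z = trans (act₀-adjoint v z (root i)) (trans (cong ⟨ z ,_⟩ e) (⟨,⟩-negʳ (root j) z))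

  -- Alcoves as intersections of strips

  translation : W → V n
  translation x = proj₁ (proj₁ x)

  linearPart : W → W₀
  linearPart x = proj₂ x

  ⟨act,⟩ : ∀ x z β → ⟨ act x z , β ⟩ ≡ ⟨ translation x , β ⟩ + ⟨ z , act₀ (reverse (linearPart x)) β ⟩
  ⟨act,⟩ x z β = trans (⟨,⟩-⊕ˡ (translation x) (act₀ (linearPart x) z) β)
                       (cong (⟨ translation x , β ⟩ +_) (act₀-adjoint (linearPart x) z β))

  -- Opaque: unfolding the integrality proof behind base makes type checking blow up.
  opaque
    base : W → Fin m → ℤ
    base x i = proj₁ (lattice-integral (proj₂ (proj₁ x)) i)

    ⟨translation,root⟩ : ∀ x i → ⟨ translation x , root i ⟩ ≡ ℤ→ℚ (base x i)
    ⟨translation,root⟩ x i = proj₂ (lattice-integral (proj₂ (proj₁ x)) i)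

  -- For x = t^μ u, ⟨ act x z , αᵢ ⟩ = ⟨ μ , αᵢ ⟩ ± ⟨ z , αⱼ ⟩ where u⁻¹ αᵢ = ± αⱼ with αⱼ positive,
  -- so x c𝒻 lies in the unit strip of ⟨ · , αᵢ ⟩ starting at ⟨ μ , αᵢ ⟩, resp. ⟨ μ , αᵢ ⟩ - 1.
  level : W → Fin m → ℤ
  level x i with act₀-signed (reverse (linearPart x)) i
  ... | +root _ _ = base x i
  ... | -root _ _ = ℤ.pred (base x i)

  level-+root : ∀ x i {j} → Positive j → act₀ (reverse (linearPart x)) (root i) ≡ root j → level x i ≡ base x i
  level-+root x i j>0 e with act₀-signed (reverse (linearPart x)) i
  ... | +root _ _    = refl
  ... | -root k>0 e′ = ⊥-elim (positive≢-positive j>0 k>0 (trans (sym e) e′))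

  level--root : ∀ x i {j} → Positive j → act₀ (reverse (linearPart x)) (root i) ≡ -ᵛ root j → level x i ≡ ℤ.pred (base x i)
  level--root x i j>0 e with act₀-signed (reverse (linearPart x)) i
  ... | +root k>0 e′ = ⊥-elim (positive≢-positive k>0 j>0 (trans (sym e′) e))
  ... | -root _ _    = refl

  level≤base≤suc[level] : ∀ x i → level x i ℤ.≤ base x i × base x i ℤ.≤ ℤ.suc (level x i)
  level≤base≤suc[level] x i = by-sign (act₀-signed (reverse (linearPart x)) i)
    where
    by-sign : SignedRoot (act₀ (reverse (linearPart x)) (root i)) → level x i ℤ.≤ base x i × base x i ℤ.≤ ℤ.suc (level x i)
    by-sign (+root j>0 e) = subst (λ a → a ℤ.≤ base x i × base x i ℤ.≤ ℤ.suc a) (sym (level-+root x i j>0 e))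
                              (ℤ.≤-refl , ℤ.i≤suc[i] (base x i))
    by-sign (-root j>0 e) = subst (λ a → a ℤ.≤ base x i × base x i ℤ.≤ ℤ.suc a) (sym (level--root x i j>0 e))
                              (ℤ.<⇒≤ (pred[k]<k (base x i)) , ℤ.≤-reflexive (sym (ℤ.suc-pred (base x i))))

  ⟨act,⟩-+root : ∀ x i {j} → act₀ (reverse (linearPart x)) (root i) ≡ root j →
                 ∀ z → ⟨ act x z , root i ⟩ ≡ ℤ→ℚ (base x i) + ⟨ z , root j ⟩
  ⟨act,⟩-+root x i e z = trans (⟨act,⟩ x z (root i)) (cong₂ _+_ (⟨translation,root⟩ x i) (cong ⟨ z ,_⟩ e))

  ⟨act,⟩--root : ∀ x i {j} → act₀ (reverse (linearPart x)) (root i) ≡ -ᵛ root j →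
                 ∀ z → ⟨ act x z , root i ⟩ ≡ ℤ→ℚ (base x i) - ⟨ z , root j ⟩
  ⟨act,⟩--root x i {j} e z = trans (⟨act,⟩ x z (root i))
    (cong₂ _+_ (⟨translation,root⟩ x i) (trans (cong ⟨ z ,_⟩ e) (⟨,⟩-negʳ (root j) z)))

  alcove⇒strip : ∀ {x z} → InAlcove x z → ∀ i → Strip (level x i) ⟨ z , root i ⟩
  alcove⇒strip {x} (z , z∈c , refl) i = by-sign (act₀-signed (reverse (linearPart x)) i)
    where
    by-sign : SignedRoot (act₀ (reverse (linearPart x)) (root i)) → Strip (level x i) ⟨ act x z , root i ⟩
    by-sign (+root {j} j>0 e) = subst₂ Strip (sym (level-+root x i j>0 e)) (sym (⟨act,⟩-+root x i e z))
                                  (strip-+ {base x i} (proj₁ (z∈c j j>0)) (proj₂ (z∈c j j>0)))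
    by-sign (-root {j} j>0 e) = subst₂ Strip (sym (level--root x i j>0 e)) (sym (⟨act,⟩--root x i e z))
                                  (strip-pred {base x i} (proj₁ (z∈c j j>0)) (proj₂ (z∈c j j>0)))

  centre : W → V n
  centre x = act x ξ₀

  centre∈alcove : ∀ x → InAlcove x (centre x)
  centre∈alcove x = ξ₀ , ξ₀∈c𝒻 , refl

  centre-strictStrip : ∀ x i → StrictStrip (level x i) ⟨ centre x , root i ⟩
  centre-strictStrip x i = by-sign (act₀-signed (reverse (linearPart x)) i)
    where
    by-sign : SignedRoot (act₀ (reverse (linearPart x)) (root i)) → StrictStrip (level x i) ⟨ centre x , root i ⟩
    by-sign (+root {j} j>0 e) = subst₂ StrictStrip (sym (level-+root x i j>0 e)) (sym (⟨act,⟩-+root x i e ξ₀))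
                                  (strictStrip-+ {base x i} (proj₁ (ξ₀-interior j j>0)) (proj₂ (ξ₀-interior j j>0)))
    by-sign (-root {j} j>0 e) = subst₂ StrictStrip (sym (level--root x i j>0 e)) (sym (⟨act,⟩--root x i e ξ₀))
                                  (strictStrip-pred {base x i} (proj₁ (ξ₀-interior j j>0)) (proj₂ (ξ₀-interior j j>0)))

  strips⇒alcove : ∀ x z → (∀ i → Positive i → Strip (level x i) ⟨ z , root i ⟩) → InAlcove x z
  strips⇒alcove x z z∈strips = z′ , z′∈c , sym act-z′
    where
    u = linearPart x
    μ = translation x
    z′ = act₀ (reverse u) (z ⊕ -ᵛ μ)
    act-z′ : act x z′ ≡ z
    act-z′ = trans (cong (μ ⊕_) (act₀-reverseˡ u (z ⊕ -ᵛ μ))) (⊕-cancel μ z)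
    ⟨z′,⟩ : ∀ β → ⟨ z′ , β ⟩ ≡ ⟨ z ⊕ -ᵛ μ , act₀ u β ⟩
    ⟨z′,⟩ β = trans (act₀-adjoint (reverse u) (z ⊕ -ᵛ μ) β) (cong (λ l → ⟨ z ⊕ -ᵛ μ , act₀ l β ⟩) (reverse-involutive u))
    ⟨z-μ,⟩ : ∀ l → ⟨ z ⊕ -ᵛ μ , root l ⟩ ≡ ⟨ z , root l ⟩ - ℤ→ℚ (base x l)
    ⟨z-μ,⟩ l = trans (⟨,⟩-⊕ˡ z (-ᵛ μ) (root l))
                     (cong (⟨ z , root l ⟩ +_) (trans (⟨,⟩-negˡ μ (root l)) (cong -_ (⟨translation,root⟩ x l))))
    z′∈c : Incf z′
    z′∈c j j>0 with act₀-signed u j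
    ... | +root {l} l>0 e = subst (λ t → 0ℚ ≤ t × t ≤ 1ℚ) (sym (trans (⟨z′,⟩ (root j)) (trans (cong ⟨ z ⊕ -ᵛ μ ,_⟩ e) (⟨z-μ,⟩ l))))
                              (strip⇒offset {base x l} (subst (λ a → Strip a ⟨ z , root l ⟩) (level-+root x l j>0 u⁻¹αₗ≡αⱼ) (z∈strips l l>0)))
      where
      u⁻¹αₗ≡αⱼ : act₀ (reverse u) (root l) ≡ root j
      u⁻¹αₗ≡αⱼ = act₀-reverse-≡ u e
    ... | -root {l} l>0 e = subst (λ t → 0ℚ ≤ t × t ≤ 1ℚ) (sym ⟨z′,αⱼ⟩)
                              (strip-pred⇒offset {base x l} (subst (λ a → Strip a ⟨ z , root l ⟩) (level--root x l j>0 u⁻¹αₗ≡-αⱼ) (z∈strips l l>0)))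
      where
      u⁻¹αₗ≡-αⱼ : act₀ (reverse u) (root l) ≡ -ᵛ root j
      u⁻¹αₗ≡-αⱼ = act₀-reverse-≡ u (trans (act₀-· u (- 1ℚ) (root j)) (trans (cong -ᵛ_ e) (-ᵛ-involutive (root l))))
      ⟨z′,αⱼ⟩ : ⟨ z′ , root j ⟩ ≡ ℤ→ℚ (base x l) - ⟨ z , root l ⟩
      ⟨z′,αⱼ⟩ = begin
        ⟨ z′ , root j ⟩                                 ≡⟨ ⟨z′,⟩ (root j) ⟩
        ⟨ z ⊕ -ᵛ μ , act₀ u (root j) ⟩                  ≡⟨ cong ⟨ z ⊕ -ᵛ μ ,_⟩ e ⟩
        ⟨ z ⊕ -ᵛ μ , -ᵛ root l ⟩                        ≡⟨ ⟨,⟩-negʳ (root l) (z ⊕ -ᵛ μ) ⟩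
        - ⟨ z ⊕ -ᵛ μ , root l ⟩                         ≡⟨ cong -_ (⟨z-μ,⟩ l) ⟩
        - (⟨ z , root l ⟩ - ℤ→ℚ (base x l))             ≡⟨ solve 2 (λ a b → :- (a :- b) := b :- a) refl ⟨ z , root l ⟩ (ℤ→ℚ (base x l)) ⟩
        ℤ→ℚ (base x l) - ⟨ z , root l ⟩                 ∎
        where open ≡-Reasoning

  sameAlcove-refl : ∀ {c} → SameAlcove c c
  sameAlcove-refl = (λ z z∈c → z∈c) , (λ z z∈c → z∈c)

  sameAlcove-sym : ∀ {c c′} → SameAlcove c c′ → SameAlcove c′ c
  sameAlcove-sym (c⊆c′ , c′⊆c) = c′⊆c , c⊆c′

  sameAlcove⇒level≡ : ∀ {x y} → SameAlcove x y → ∀ i → level x i ≡ level y i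
  sameAlcove⇒level≡ {x} {y} (x⊆y , _) i =
    strip-unique {level x i} {level y i} (centre-strictStrip x i) (alcove⇒strip {y} (x⊆y (centre x) (centre∈alcove x)) i)

  level≡⇒sameAlcove : ∀ {x y} → (∀ i → Positive i → level x i ≡ level y i) → SameAlcove x y
  level≡⇒sameAlcove {x} {y} x≡y =
      (λ z z∈x → strips⇒alcove y z λ i i>0 → subst (λ a → Strip a ⟨ z , root i ⟩) (x≡y i i>0) (alcove⇒strip {x} z∈x i))
    , (λ z z∈y → strips⇒alcove x z λ i i>0 → subst (λ a → Strip a ⟨ z , root i ⟩) (sym (x≡y i i>0)) (alcove⇒strip {y} z∈y i))

  -- Walls, panels and affine reflections

  height : Wall → ℤ
  height H = proj₂ H

  level-at-wall : ∀ {c p H} → p ⊆ InAlcove c → p ⊆ InWall H → ∃ p →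
                  level c (cls H) ≡ height H ⊎ level c (cls H) ≡ ℤ.pred (height H)
  level-at-wall {c} {p} {(h , _) , k} p⊆c p⊆H (z , z∈p) =
    strip-at-integer (subst (Strip (level c h)) (p⊆H z z∈p) (alcove⇒strip {c} (p⊆c z z∈p) h))

  UniqueWall : (V n → Set) → Wall → Set
  UniqueWall p H = ∀ H′ → p ⊆ InWall H′ → SameWall H′ H

  levels-agree-off-wall : ∀ {c c′ p H} → p ⊆ InAlcove c → p ⊆ InAlcove c′ → UniqueWall p H →
                          ∀ i → Positive i → i ≢ cls H → level c i ≡ level c′ i
  levels-agree-off-wall {c} {c′} {p} p⊆c p⊆c′ unique i i>0 i≢h with ℤ.<-cmp (level c i) (level c′ i)
  ... | tri< a<a′ _ _ = ⊥-elim (i≢h (proj₁ (unique ((i , i>0) , level c′ i) λ z z∈p →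
                          strips-meet (alcove⇒strip {c} (p⊆c z z∈p) i) (alcove⇒strip {c′} (p⊆c′ z z∈p) i) a<a′)))
  ... | tri≈ _ a≡a′ _ = a≡a′
  ... | tri> _ _ a′<a = ⊥-elim (i≢h (proj₁ (unique ((i , i>0) , level c i) λ z z∈p →
                          strips-meet (alcove⇒strip {c′} (p⊆c′ z z∈p) i) (alcove⇒strip {c} (p⊆c z z∈p) i) a′<a)))

  sameWall-sym : ∀ {H H′} → SameWall H H′ → SameWall H′ H
  sameWall-sym (i≡j , k≡l) = sym i≡j , sym k≡l

  sameWall-trans : ∀ {H H′ H″} → SameWall H H′ → SameWall H′ H″ → SameWall H H″
  sameWall-trans (i≡j , k≡l) (j≡j′ , l≡l′) = trans i≡j j≡j′ , trans k≡l l≡l′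

  sameWall⇒⊆ : ∀ {H H′} → SameWall H H′ → InWall H ⊆ InWall H′
  sameWall⇒⊆ {(i , _) , k} {(.i , _) , .k} (refl , refl) z z∈H = z∈H

  ⟨d,d⟩≡0⇒d≡𝟘 : ∀ d → ⟨ d , d ⟩ ≡ 0ℚ → d ≡ 𝟘
  ⟨d,d⟩≡0⇒d≡𝟘 d ⟨d,d⟩≡0 with ≡-dec _≟_ d 𝟘
  ... | yes d≡0 = d≡0
  ... | no  d≢0 = ⊥-elim (<-irrefl (sym ⟨d,d⟩≡0) (posdef d d≢0))

  positive-multiple⇒≡ : ∀ {b g} c → Positive b → Positive g → root g ≡ c · root b → b ≡ g
  positive-multiple⇒≡ {b} {g} c b>0 g>0 g≡cb with reduced b g c g≡cb
  ... | inj₁ c≡1  = root-inj b g (sym (trans g≡cb (trans (cong (_· root b) c≡1) (1·-identity (root b)))))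
  ... | inj₂ c≡-1 = ⊥-elim (positive≢-positive g>0 b>0 (trans g≡cb (cong (_· root b) c≡-1)))

  wallPoint : Fin m → ℤ → V n
  wallPoint b l = (ℤ→ℚ l * (1ℚ ÷' ⟨ root b , root b ⟩)) · root b

  wallPoint∈wall : ∀ b l → ⟨ wallPoint b l , root b ⟩ ≡ ℤ→ℚ l
  wallPoint∈wall b l = begin
    ⟨ (ℤ→ℚ l * I) · β , β ⟩   ≡⟨ ⟨,⟩-·ˡ (ℤ→ℚ l * I) β β ⟩
    ℤ→ℚ l * I * ⟨ β , β ⟩     ≡⟨ solve 3 (λ l i n → l :* i :* n := l :* (n :* i)) refl (ℤ→ℚ l) I ⟨ β , β ⟩ ⟩
    ℤ→ℚ l * (⟨ β , β ⟩ * I)   ≡⟨ cong (ℤ→ℚ l *_) (÷-inverseʳ (⟨root,root⟩≢0 b)) ⟩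
    ℤ→ℚ l * 1ℚ                ≡⟨ *-identityʳ (ℤ→ℚ l) ⟩
    ℤ→ℚ l                     ∎
    where
    open ≡-Reasoning
    β = root b
    I = 1ℚ ÷' ⟨ β , β ⟩

  orthogonalPart : V n → V n → V n
  orthogonalPart γ β = γ ⊕ ((- (⟨ γ , β ⟩ * (1ℚ ÷' ⟨ β , β ⟩))) · β)

  ⟨orthogonalPart,⟩≡0 : ∀ γ {β} → ⟨ β , β ⟩ ≢ 0ℚ → ⟨ orthogonalPart γ β , β ⟩ ≡ 0ℚ
  ⟨orthogonalPart,⟩≡0 γ {β} β≢0 = begin
    ⟨ γ ⊕ ((- c) · β) , β ⟩                    ≡⟨ ⟨,⟩-⊕ˡ γ ((- c) · β) β ⟩
    ⟨ γ , β ⟩ + ⟨ (- c) · β , β ⟩             ≡⟨ cong (⟨ γ , β ⟩ +_) (⟨,⟩-·ˡ (- c) β β) ⟩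
    ⟨ γ , β ⟩ + (- c) * ⟨ β , β ⟩             ≡⟨ solve 3 (λ g i n → g :+ (:- (g :* i)) :* n := g :- g :* (n :* i)) refl ⟨ γ , β ⟩ I ⟨ β , β ⟩ ⟩
    ⟨ γ , β ⟩ - ⟨ γ , β ⟩ * (⟨ β , β ⟩ * I)   ≡⟨ cong (λ t → ⟨ γ , β ⟩ - ⟨ γ , β ⟩ * t) (÷-inverseʳ β≢0) ⟩
    ⟨ γ , β ⟩ - ⟨ γ , β ⟩ * 1ℚ                ≡⟨ solve 1 (λ g → g :- g :* con 1ℚ := con 0ℚ) refl ⟨ γ , β ⟩ ⟩
    0ℚ                                        ∎
    where
    open ≡-Reasoning
    I = 1ℚ ÷' ⟨ β , β ⟩
    c = ⟨ γ , β ⟩ * I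

  wall⊆⇒sameWall : ∀ H H′ → InWall H ⊆ InWall H′ → SameWall H H′
  wall⊆⇒sameWall ((b , b>0) , l) ((g , g>0) , l′) H⊆H′ = b≡g , ℤ→ℚ-injective l≡l′
    where
    β = root b
    γ = root g
    c = ⟨ γ , β ⟩ * (1ℚ ÷' ⟨ β , β ⟩)
    z₁ = wallPoint b l
    d = orthogonalPart γ β
    ⟨d,β⟩≡0 : ⟨ d , β ⟩ ≡ 0ℚ
    ⟨d,β⟩≡0 = ⟨orthogonalPart,⟩≡0 γ (⟨root,root⟩≢0 b)
    z₁∈H′ : ⟨ z₁ , γ ⟩ ≡ ℤ→ℚ l′
    z₁∈H′ = H⊆H′ z₁ (wallPoint∈wall b l)
    z₁+d∈H′ : ⟨ z₁ ⊕ d , γ ⟩ ≡ ℤ→ℚ l′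
    z₁+d∈H′ = H⊆H′ (z₁ ⊕ d) (trans (⟨,⟩-⊕ˡ z₁ d β) (trans (cong₂ _+_ (wallPoint∈wall b l) ⟨d,β⟩≡0) (+-identityʳ (ℤ→ℚ l))))
    ⟨d,γ⟩≡0 : ⟨ d , γ ⟩ ≡ 0ℚ
    ⟨d,γ⟩≡0 = begin
      ⟨ d , γ ⟩                             ≡⟨ solve 2 (λ a b → b := (a :+ b) :- a) refl ⟨ z₁ , γ ⟩ ⟨ d , γ ⟩ ⟩
      (⟨ z₁ , γ ⟩ + ⟨ d , γ ⟩) - ⟨ z₁ , γ ⟩  ≡⟨ cong₂ _-_ (trans (sym (⟨,⟩-⊕ˡ z₁ d γ)) z₁+d∈H′) z₁∈H′ ⟩
      ℤ→ℚ l′ - ℤ→ℚ l′                       ≡⟨ +-inverseʳ (ℤ→ℚ l′) ⟩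
      0ℚ                                    ∎
      where open ≡-Reasoning
    ⟨d,d⟩≡0 : ⟨ d , d ⟩ ≡ 0ℚ
    ⟨d,d⟩≡0 = begin
      ⟨ d , d ⟩                             ≡⟨ ⟨,⟩-⊕ˡ γ ((- c) · β) d ⟩
      ⟨ γ , d ⟩ + ⟨ (- c) · β , d ⟩         ≡⟨ cong₂ _+_ (⟨,⟩-comm γ d) (⟨,⟩-·ˡ (- c) β d) ⟩
      ⟨ d , γ ⟩ + (- c) * ⟨ β , d ⟩         ≡⟨ cong₂ (λ a b → a + (- c) * b) ⟨d,γ⟩≡0 (trans (⟨,⟩-comm β d) ⟨d,β⟩≡0) ⟩
      0ℚ + (- c) * 0ℚ                       ≡⟨ solve 1 (λ c → con 0ℚ :+ (:- c) :* con 0ℚ := con 0ℚ) refl c ⟩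
      0ℚ                                    ∎
      where open ≡-Reasoning
    b≡g : b ≡ g
    b≡g = positive-multiple⇒≡ c b>0 g>0 (⊕-·≡𝟘⇒≡· c (⟨d,d⟩≡0⇒d≡𝟘 d ⟨d,d⟩≡0))
    l≡l′ : ℤ→ℚ l ≡ ℤ→ℚ l′
    l≡l′ = trans (sym (wallPoint∈wall b l)) (trans (cong (λ j → ⟨ z₁ , root j ⟩) b≡g) z₁∈H′)

  reflectIn : Wall → V n → V n
  reflectIn ((h , _) , k) z = z ⊕ ((ℤ→ℚ k - ⟨ z , root h ⟩) · coroot (root h))

  ⟨reflectIn,⟩ : ∀ H z β → ⟨ reflectIn H z , β ⟩ ≡
                 ⟨ z , β ⟩ + (ℤ→ℚ (height H) - ⟨ z , root (cls H) ⟩) * ⟨ β , coroot (root (cls H)) ⟩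
  ⟨reflectIn,⟩ ((h , _) , k) z β = trans (⟨,⟩-⊕ˡ z (t · coroot (root h)) β) (cong (⟨ z , β ⟩ +_)
    (trans (⟨,⟩-·ˡ t (coroot (root h)) β) (cong (t *_) (⟨,⟩-comm (coroot (root h)) β))))
    where t = ℤ→ℚ k - ⟨ z , root h ⟩

  ⟨reflectIn,α⟩ : ∀ H z → ⟨ reflectIn H z , root (cls H) ⟩ ≡ ℤ→ℚ (height H) + ℤ→ℚ (height H) - ⟨ z , root (cls H) ⟩
  ⟨reflectIn,α⟩ H@((h , _) , k) z = begin
    ⟨ reflectIn H z , α ⟩                                ≡⟨ ⟨reflectIn,⟩ H z α ⟩
    ⟨ z , α ⟩ + (ℤ→ℚ k - ⟨ z , α ⟩) * ⟨ α , coroot α ⟩   ≡⟨ cong (λ t → ⟨ z , α ⟩ + (ℤ→ℚ k - ⟨ z , α ⟩) * t)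
                                                              (⟨α,α∨⟩≡2 {α} (⟨root,root⟩≢0 h)) ⟩
    ⟨ z , α ⟩ + (ℤ→ℚ k - ⟨ z , α ⟩) * 2ℚ                 ≡⟨ solve 2 (λ t k → t :+ (k :- t) :* con 2ℚ := k :+ k :- t) refl ⟨ z , α ⟩ (ℤ→ℚ k) ⟩
    ℤ→ℚ k + ℤ→ℚ k - ⟨ z , α ⟩                            ∎
    where
    open ≡-Reasoning
    α = root h

  reflectIn-fixes : ∀ H {z} → InWall H z → reflectIn H z ≡ z
  reflectIn-fixes ((h , _) , k) {z} z∈H =
    trans (cong (λ t → z ⊕ (t · coroot (root h))) (trans (cong (λ t → ℤ→ℚ k - t) z∈H) (+-inverseʳ (ℤ→ℚ k)))) (⊕-zero· z (coroot (root h)))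

  reflectIn-involutive : ∀ H z → reflectIn H (reflectIn H z) ≡ z
  reflectIn-involutive H@((h , _) , k) z = trans (cong (λ t → reflectIn H z ⊕ (t · coroot (root h))) coefficient)
                                                 (⊕-·-cancel z (coroot (root h)) (ℤ→ℚ k - ⟨ z , root h ⟩))
    where
    coefficient : ℤ→ℚ k - ⟨ reflectIn H z , root h ⟩ ≡ - (ℤ→ℚ k - ⟨ z , root h ⟩)
    coefficient = trans (cong (λ t → ℤ→ℚ k - t) (⟨reflectIn,α⟩ H z))
      (solve 2 (λ k t → k :- (k :+ k :- t) := :- (k :- t)) refl (ℤ→ℚ k) ⟨ z , root h ⟩)

  ⟨reflectIn,⟩-reflect : ∀ H z β → ⟨ reflectIn H z , β ⟩ ≡
                         ⟨ z , reflect (root (cls H)) β ⟩ + ℤ→ℚ (height H) * ⟨ β , coroot (root (cls H)) ⟩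
  ⟨reflectIn,⟩-reflect H@((h , _) , k) z β = begin
    ⟨ reflectIn H z , β ⟩                                       ≡⟨ ⟨reflectIn,⟩ H z β ⟩
    ⟨ z , β ⟩ + (ℤ→ℚ k - ⟨ z , α ⟩) * ⟨ β , coroot α ⟩          ≡⟨ solve 4 (λ x k t c → x :+ (k :- t) :* c := x :- c :* t :+ k :* c) refl
                                                                      ⟨ z , β ⟩ (ℤ→ℚ k) ⟨ z , α ⟩ ⟨ β , coroot α ⟩ ⟩
    ⟨ z , β ⟩ - ⟨ β , coroot α ⟩ * ⟨ z , α ⟩ + ℤ→ℚ k * ⟨ β , coroot α ⟩
                                                                ≡⟨ cong₂ (λ a b → a - ⟨ β , coroot α ⟩ * b + ℤ→ℚ k * ⟨ β , coroot α ⟩)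
                                                                         (⟨,⟩-comm z β) (⟨,⟩-comm z α) ⟩
    ⟨ β , z ⟩ - ⟨ β , coroot α ⟩ * ⟨ α , z ⟩ + ℤ→ℚ k * ⟨ β , coroot α ⟩
                                                                ≡⟨ cong (_+ ℤ→ℚ k * ⟨ β , coroot α ⟩)
                                                                        (sym (trans (⟨,⟩-comm z (reflect α β)) (⟨,⟩-reflectˡ α β z))) ⟩
    ⟨ z , reflect α β ⟩ + ℤ→ℚ k * ⟨ β , coroot α ⟩              ∎
    where
    open ≡-Reasoning
    α = root h

  reflectWall : ∀ H H′ → ∃ λ H″ → ∀ z → InWall H″ z ⇔ InWall H′ (reflectIn H z)
  reflectWall H@((h , _) , k) H′@((b , _) , l) = by-sign (root-signed j)
    where
    j = proj₁ (reflect-closed h b)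
    sβ≡root : reflect (root h) (root b) ≡ root j
    sβ≡root = sym (proj₂ (reflect-closed h b))
    c = proj₁ (⟨root,coroot⟩-integral b h)
    K = ℤ→ℚ k * ℤ→ℚ c
    ⟨sz,β⟩ : ∀ z → ⟨ reflectIn H z , root b ⟩ ≡ ⟨ z , root j ⟩ + K
    ⟨sz,β⟩ z = trans (⟨reflectIn,⟩-reflect H z (root b))
      (cong₂ _+_ (cong ⟨ z ,_⟩ sβ≡root) (cong (ℤ→ℚ k *_) (proj₂ (⟨root,coroot⟩-integral b h))))
    by-sign : SignedRoot (root j) → ∃ λ H″ → ∀ z → InWall H″ z ⇔ InWall H′ (reflectIn H z)
    by-sign (+root {g} g>0 e) = ((g , g>0) , l ℤ.- k ℤ.* c) , λ z → mk⇔
      (λ z∈H″ → trans (trans (⟨sz,β⟩ z) (cong (_+ K) (cong ⟨ z ,_⟩ e)))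
                      (Equivalence.from (x+k≡l⇔x≡l-k _ K (ℤ→ℚ l)) (trans z∈H″ l-kc)))
      (λ sz∈H′ → trans (Equivalence.to (x+k≡l⇔x≡l-k _ K (ℤ→ℚ l)) (trans (sym (trans (⟨sz,β⟩ z) (cong (_+ K) (cong ⟨ z ,_⟩ e)))) sz∈H′))
                       (sym l-kc))
      where
      l-kc : ℤ→ℚ (l ℤ.- k ℤ.* c) ≡ ℤ→ℚ l - K
      l-kc = trans (ℤ→ℚ-homo-sub l (k ℤ.* c)) (cong (λ t → ℤ→ℚ l - t) (ℤ→ℚ-homo-* k c))
    by-sign (-root {g} g>0 e) = ((g , g>0) , k ℤ.* c ℤ.- l) , λ z → mk⇔
      (λ z∈H″ → trans (⟨sz,β⟩′ z) (Equivalence.from (-x+k≡l⇔x≡k-l _ K (ℤ→ℚ l)) (trans z∈H″ kc-l)))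
      (λ sz∈H′ → trans (Equivalence.to (-x+k≡l⇔x≡k-l _ K (ℤ→ℚ l)) (trans (sym (⟨sz,β⟩′ z)) sz∈H′)) (sym kc-l))
      where
      kc-l : ℤ→ℚ (k ℤ.* c ℤ.- l) ≡ K - ℤ→ℚ l
      kc-l = trans (ℤ→ℚ-homo-sub (k ℤ.* c) l) (cong (_- ℤ→ℚ l) (ℤ→ℚ-homo-* k c))
      ⟨sz,β⟩′ : ∀ z → ⟨ reflectIn H z , root b ⟩ ≡ - ⟨ z , root g ⟩ + K
      ⟨sz,β⟩′ z = trans (⟨sz,β⟩ z) (cong (_+ K) (trans (cong ⟨ z ,_⟩ e) (⟨,⟩-negʳ (root g) z)))

  -- Opaque for the same reason as base.
  opaque
    lattice-reflectIn : ∀ H {μ} → InCorootLattice μ → InCorootLattice (reflectIn H μ)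
    lattice-reflectIn ((h , _) , k) {μ} μ∈R∨ =
      subst (λ t → InCorootLattice (μ ⊕ (t · coroot (root h)))) coefficient (lattice-⊕ μ∈R∨ (lattice-coroot h (k ℤ.- b)))
      where
      b : ℤ
      b = proj₁ (lattice-integral μ∈R∨ h)
      coefficient : ℤ→ℚ (k ℤ.- b) ≡ ℤ→ℚ k - ⟨ μ , root h ⟩
      coefficient = trans (ℤ→ℚ-homo-sub k b) (cong (λ t → ℤ→ℚ k - t) (sym (proj₂ (lattice-integral μ∈R∨ h))))

  reflectAlcove : Wall → W → W
  reflectAlcove H x = (reflectIn H (translation x) , lattice-reflectIn H (proj₂ (proj₁ x))) , cls H ∷ linearPart x

  act-reflectAlcove : ∀ H x z → act (reflectAlcove H x) z ≡ reflectIn H (act x z)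
  act-reflectAlcove H@((h , _) , k) x z = begin
    (μ ⊕ (a · v)) ⊕ reflect α w                ≡⟨ cong ((μ ⊕ (a · v)) ⊕_) (reflect-via-coroot α w) ⟩
    (μ ⊕ (a · v)) ⊕ (w ⊕ ((- ⟨ w , α ⟩) · v))  ≡⟨ ⊕-·-interchange μ w v a (- ⟨ w , α ⟩) ⟩
    (μ ⊕ w) ⊕ ((a + - ⟨ w , α ⟩) · v)          ≡⟨ cong (λ t → (μ ⊕ w) ⊕ (t · v)) coefficient ⟩
    (μ ⊕ w) ⊕ ((ℤ→ℚ k - ⟨ μ ⊕ w , α ⟩) · v)    ∎
    where
    open ≡-Reasoning
    α = root h
    v = coroot α
    μ = translation x
    w = act₀ (linearPart x) z
    a = ℤ→ℚ k - ⟨ μ , α ⟩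
    coefficient : a + - ⟨ w , α ⟩ ≡ ℤ→ℚ k - ⟨ μ ⊕ w , α ⟩
    coefficient = trans (solve 3 (λ k m w → k :- m :+ (:- w) := k :- (m :+ w)) refl (ℤ→ℚ k) ⟨ μ , α ⟩ ⟨ w , α ⟩)
                        (cong (λ t → ℤ→ℚ k - t) (sym (⟨,⟩-⊕ˡ μ w α)))

  inAlcove-reflectAlcove : ∀ H x z → InAlcove (reflectAlcove H x) z ⇔ InAlcove x (reflectIn H z)
  inAlcove-reflectAlcove H x z = mk⇔
    (λ { (z′ , z′∈c , z≡) → z′ , z′∈c ,
           trans (cong (reflectIn H) (trans z≡ (act-reflectAlcove H x z′))) (reflectIn-involutive H (act x z′)) })
    (λ { (z′ , z′∈c , sz≡) → z′ , z′∈c ,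
           trans (sym (reflectIn-involutive H z)) (trans (cong (reflectIn H) sz≡) (sym (act-reflectAlcove H x z′))) })

  level-reflectAlcove : ∀ H c → level (reflectAlcove H c) (cls H) ≡ ℤ.pred (height H ℤ.+ height H ℤ.- level c (cls H))
  level-reflectAlcove H@((h , _) , k) c = sym (strip-unique
    (subst (StrictStrip (ℤ.pred (k ℤ.+ k ℤ.- level c h))) (sym (⟨reflectIn,α⟩ H (centre c))) (strictStrip-mirror k (centre-strictStrip c h)))
    (alcove⇒strip {reflectAlcove H c} (Equivalence.from (inAlcove-reflectAlcove H c (reflectIn H (centre c)))
      (subst (InAlcove c) (sym (reflectIn-involutive H (centre c))) (centre∈alcove c))) h))

  wall∩alcove⊆reflectAlcove : ∀ {H c p} → p ⊆ InWall H → p ⊆ InAlcove c → p ⊆ InAlcove (reflectAlcove H c)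
  wall∩alcove⊆reflectAlcove {H} {c} p⊆H p⊆c z z∈p =
    Equivalence.from (inAlcove-reflectAlcove H c z) (subst (InAlcove c) (sym (reflectIn-fixes H (p⊆H z z∈p))) (p⊆c z z∈p))

  reflectPanel : Wall → (V n → Set) → V n → Set
  reflectPanel H p z = p (reflectIn H z)

  reflectPanel-⊆ : ∀ H {p c} → p ⊆ InAlcove c → reflectPanel H p ⊆ InAlcove (reflectAlcove H c)
  reflectPanel-⊆ H {c = c} p⊆c z z∈p′ = Equivalence.from (inAlcove-reflectAlcove H c z) (p⊆c (reflectIn H z) z∈p′)

  reflectPanel-⊆-wall : ∀ H {p H′} → p ⊆ InWall H′ → reflectPanel H p ⊆ InWall (proj₁ (reflectWall H H′))
  reflectPanel-⊆-wall H {H′ = H′} p⊆H′ z z∈p′ = Equivalence.from (proj₂ (reflectWall H H′) z) (p⊆H′ (reflectIn H z) z∈p′)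

  isPanel-reflect : ∀ H {p} → IsPanel p → IsPanel (reflectPanel H p)
  isPanel-reflect H {p} (x , Hₚ , p⇔ , (z₀ , z₀∈p) , unique) =
    reflectAlcove H x , H″ , p′⇔ , (reflectIn H z₀ , subst p (sym (reflectIn-involutive H z₀)) z₀∈p) , unique′
    where
    H″ = proj₁ (reflectWall H Hₚ)
    p′⇔ : ∀ z → reflectPanel H p z ⇔ (InAlcove (reflectAlcove H x) z × InWall H″ z)
    p′⇔ z = mk⇔
      (λ sz∈p → let (sz∈x , sz∈Hₚ) = Equivalence.to (p⇔ (reflectIn H z)) sz∈p
                in Equivalence.from (inAlcove-reflectAlcove H x z) sz∈x , Equivalence.from (proj₂ (reflectWall H Hₚ) z) sz∈Hₚ)
      (λ { (z∈σx , z∈H″) → Equivalence.from (p⇔ (reflectIn H z))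
             (Equivalence.to (inAlcove-reflectAlcove H x z) z∈σx , Equivalence.to (proj₂ (reflectWall H Hₚ) z) z∈H″) })
    unique′ : UniqueWall (reflectPanel H p) H″
    unique′ H‴ p′⊆H‴ = wall⊆⇒sameWall H‴ H″ λ z z∈H‴ →
      Equivalence.from (proj₂ (reflectWall H Hₚ) z)
        (sameWall⇒⊆ {M} {Hₚ} M≈Hₚ (reflectIn H z) (Equivalence.from (proj₂ (reflectWall H H‴) (reflectIn H z))
          (subst (InWall H‴) (sym (reflectIn-involutive H z)) z∈H‴)))
      where
      M = proj₁ (reflectWall H H‴)
      M≈Hₚ : SameWall M Hₚ
      M≈Hₚ = unique M λ z z∈p → Equivalence.from (proj₂ (reflectWall H H‴) z)
        (p′⊆H‴ (reflectIn H z) (subst p (sym (reflectIn-involutive H z)) z∈p))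

  record SharedPanel (c c′ : W) (H : Wall) : Set₁ where
    field
      panel    : V n → Set
      ⊆ˡ       : panel ⊆ InAlcove c
      ⊆ʳ       : panel ⊆ InAlcove c′
      ⊆wall    : panel ⊆ InWall H
      inhabited : ∃ panel
      unique   : UniqueWall panel H

  swap : ∀ {c c′ H} → SharedPanel c c′ H → SharedPanel c′ c H
  swap P = record { panel = panel ; ⊆ˡ = ⊆ʳ ; ⊆ʳ = ⊆ˡ ; ⊆wall = ⊆wall ; inhabited = inhabited ; unique = unique }
    where open SharedPanel P

  sameLevel⇒sameAlcove : ∀ {c c′ H} → SharedPanel c c′ H → level c (cls H) ≡ level c′ (cls H) → SameAlcove c c′
  sameLevel⇒sameAlcove {c} {c′} {H} P same-at-H = level≡⇒sameAlcove {c} {c′} λ i i>0 → by-index i i>0 (i Fin.≟ cls H)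
    where
    open SharedPanel P
    by-index : ∀ i → Positive i → Dec (i ≡ cls H) → level c i ≡ level c′ i
    by-index i i>0 (yes refl) = same-at-H
    by-index i i>0 (no i≢h)   = levels-agree-off-wall {c} {c′} {panel} {H} ⊆ˡ ⊆ʳ unique i i>0 i≢h

  Up Down : W → W → Wall → Set
  Up   c c′ H = level c (cls H) ≡ ℤ.pred (height H) × level c′ (cls H) ≡ height H
  Down c c′ H = level c (cls H) ≡ height H × level c′ (cls H) ≡ ℤ.pred (height H)

  crossing-levels : ∀ {c c′ H} → SharedPanel c c′ H → ¬ SameAlcove c c′ → Up c c′ H ⊎ Down c c′ H
  crossing-levels {c} {c′} {H} P c≉c′ with level-at-wall {c} {panel} {H} ⊆ˡ ⊆wall inhabited | level-at-wall {c′} {panel} {H} ⊆ʳ ⊆wall inhabited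
    where open SharedPanel P
  ... | inj₁ a≡k   | inj₁ a′≡k   = ⊥-elim (c≉c′ (sameLevel⇒sameAlcove P (trans a≡k (sym a′≡k))))
  ... | inj₁ a≡k   | inj₂ a′≡k-1 = inj₂ (a≡k , a′≡k-1)
  ... | inj₂ a≡k-1 | inj₁ a′≡k   = inj₁ (a≡k-1 , a′≡k)
  ... | inj₂ a≡k-1 | inj₂ a′≡k-1 = ⊥-elim (c≉c′ (sameLevel⇒sameAlcove P (trans a≡k-1 (sym a′≡k-1))))

  private
    module Z = ℤ-Solver.+-*-Solver

    pred[k+k-k]≡pred[k] : ∀ k → ℤ.pred (k ℤ.+ k ℤ.- k) ≡ ℤ.pred k
    pred[k+k-k]≡pred[k] = Z.solve 1 (λ k → Z.con (ℤ.- 1ℤ) Z.:+ (k Z.:+ k Z.:- k) Z.:= Z.con (ℤ.- 1ℤ) Z.:+ k) refl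

    pred[k+k-pred[k]]≡k : ∀ k → ℤ.pred (k ℤ.+ k ℤ.- ℤ.pred k) ≡ k
    pred[k+k-pred[k]]≡k = Z.solve 1 (λ k → Z.con (ℤ.- 1ℤ) Z.:+ (k Z.:+ k Z.:- (Z.con (ℤ.- 1ℤ) Z.:+ k)) Z.:= k) refl

  adjacent⇒mirror : ∀ {c c′ H} → SharedPanel c c′ H → ¬ SameAlcove c c′ → SameAlcove (reflectAlcove H c′) c
  adjacent⇒mirror {c} {c′} {H} P c≉c′ =
    sameLevel⇒sameAlcove P′ (trans (level-reflectAlcove H c′) (by-levels (crossing-levels P c≉c′)))
    where
    open SharedPanel P
    k = height H
    h = cls H
    P′ : SharedPanel (reflectAlcove H c′) c H
    P′ = record { panel = panel ; ⊆ˡ = wall∩alcove⊆reflectAlcove {H} {c′} ⊆wall ⊆ʳ ; ⊆ʳ = ⊆ˡ ; ⊆wall = ⊆wall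
                ; inhabited = inhabited ; unique = unique }
    by-levels : Up c c′ H ⊎ Down c c′ H → ℤ.pred (k ℤ.+ k ℤ.- level c′ h) ≡ level c h
    by-levels (inj₁ (a≡k-1 , a′≡k)) = trans (cong (λ a → ℤ.pred (k ℤ.+ k ℤ.- a)) a′≡k) (trans (pred[k+k-k]≡pred[k] k) (sym a≡k-1))
    by-levels (inj₂ (a≡k , a′≡k-1)) = trans (cong (λ a → ℤ.pred (k ℤ.+ k ℤ.- a)) a′≡k-1) (trans (pred[k+k-pred[k]]≡k k) (sym a≡k))

  -- Galleries

  -- Gallery with the length as an index instead of a field, so that galleries can be built and taken
  -- apart step by step.
  record Gallery[_] (L : ℕ) : Set₁ where
    field
      alc     : Fin (suc L) → W
      pan     : Fin L → V n → Set
      wall    : Fin L → Wall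
      isPanel : ∀ t → IsPanel (pan t)
      inWall  : ∀ t → pan t ⊆ InWall (wall t)
      inPrev  : ∀ t → pan t ⊆ InAlcove (alc (inject₁ t))
      inNext  : ∀ t → pan t ⊆ InAlcove (alc (suc t))

  open Gallery[_]

  first : ∀ {L} → Gallery[ L ] → W
  first δ = alc δ zero

  last : ∀ {L} → Gallery[ L ] → W
  last {L} δ = alc δ (fromℕ L)

  toGallery : ∀ {L} → Gallery[ L ] → Gallery
  toGallery {L} δ = record { len = L ; alc = alc δ ; pan = pan δ ; wall = wall δ
                           ; isPanel = isPanel δ ; inWall = inWall δ ; inPrev = inPrev δ ; inNext = inNext δ }

  fromGallery : (γ : Gallery) → Gallery[ len γ ]
  fromGallery γ = record { alc = alc γ ; pan = pan γ ; wall = wall γ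
                         ; isPanel = isPanel γ ; inWall = inWall γ ; inPrev = inPrev γ ; inNext = inNext γ }

  tail : ∀ {L} → Gallery[ suc L ] → Gallery[ L ]
  tail δ = record { alc = λ t → alc δ (suc t) ; pan = λ t → pan δ (suc t) ; wall = λ t → wall δ (suc t)
                  ; isPanel = λ t → isPanel δ (suc t) ; inWall = λ t → inWall δ (suc t)
                  ; inPrev = λ t → inPrev δ (suc t) ; inNext = λ t → inNext δ (suc t) }

  cons : ∀ {L} (c : W) (p : V n → Set) (H : Wall) → IsPanel p → p ⊆ InWall H → p ⊆ InAlcove c →
         (δ : Gallery[ L ]) → p ⊆ InAlcove (first δ) → Gallery[ suc L ]
  cons c p H p-panel p⊆H p⊆c δ p⊆δ = record
    { alc     = λ { zero → c       ; (suc t) → alc δ t }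
    ; pan     = λ { zero → p       ; (suc t) → pan δ t }
    ; wall    = λ { zero → H       ; (suc t) → wall δ t }
    ; isPanel = λ { zero → p-panel ; (suc t) → isPanel δ t }
    ; inWall  = λ { zero → p⊆H     ; (suc t) → inWall δ t }
    ; inPrev  = λ { zero → p⊆c     ; (suc t) → inPrev δ t }
    ; inNext  = λ { zero → p⊆δ     ; (suc t) → inNext δ t } }

  IsMinimal : ∀ {L} → Gallery[ L ] → Set₁
  IsMinimal {L} δ = ∀ {L′} (δ′ : Gallery[ L′ ]) → SameAlcove (first δ′) (first δ) → SameAlcove (last δ′) (last δ) → L ℕ.≤ L′

  minimal⇒isMinimal : ∀ {γ} → Minimal γ → IsMinimal (fromGallery γ)
  minimal⇒isMinimal minimal δ′ = minimal (toGallery δ′)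

  Crosses[_] : ∀ {L} → Gallery[ L ] → Fin L → Set
  Crosses[ δ ] t = ¬ SameAlcove (alc δ (inject₁ t)) (alc δ (suc t))

  stepPanel : ∀ {L} (δ : Gallery[ L ]) t → SharedPanel (alc δ (inject₁ t)) (alc δ (suc t)) (wall δ t)
  stepPanel δ t with isPanel δ t
  ... | _ , Hₚ , _ , p≠∅ , unique = record
    { panel = pan δ t ; ⊆ˡ = inPrev δ t ; ⊆ʳ = inNext δ t ; ⊆wall = inWall δ t ; inhabited = p≠∅
    ; unique = λ H′ p⊆H′ → sameWall-trans {H′} {Hₚ} {wall δ t} (unique H′ p⊆H′)
                             (sameWall-sym {wall δ t} {Hₚ} (unique (wall δ t) (inWall δ t))) }

  -- Reflects alcoves 0, …, k in H; step k still reaches alcove k + 1 since its panel lies in H.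
  reflectPrefix : ∀ {L} H (δ : Gallery[ L ]) (k : Fin L) → pan δ k ⊆ InWall H →
                  Σ (Gallery[ L ]) λ δ′ → first δ′ ≡ reflectAlcove H (first δ) × last δ′ ≡ last δ
  reflectPrefix H δ zero p⊆H =
    cons (reflectAlcove H (first δ)) (pan δ zero) (wall δ zero) (isPanel δ zero) (inWall δ zero)
         (wall∩alcove⊆reflectAlcove {H} {first δ} p⊆H (inPrev δ zero)) (tail δ) (inNext δ zero) , refl , refl
  reflectPrefix H δ (suc k) p⊆H with reflectPrefix H (tail δ) k p⊆H
  ... | δ′ , first≡ , last≡ =
    cons (reflectAlcove H (first δ)) p′ (proj₁ (reflectWall H (wall δ zero))) (isPanel-reflect H (isPanel δ zero))
         (reflectPanel-⊆-wall H {pan δ zero} {wall δ zero} (inWall δ zero)) (reflectPanel-⊆ H {pan δ zero} {first δ} (inPrev δ zero))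
         δ′ (subst (λ c → p′ ⊆ InAlcove c) (sym first≡) (reflectPanel-⊆ H {pan δ zero} {alc δ (suc zero)} (inNext δ zero)))
    , refl , last≡
    where p′ = reflectPanel H (pan δ zero)

  -- Alcove j is the mirror image of alcove j + 1 in H, so dropping alcove j + 1 and reflecting alcoves
  -- j + 2, …, i in H gives a gallery with one step less; it still reaches alcove i + 1 through the panel
  -- of step i, which lies in H.
  shorten : ∀ {L} H (δ : Gallery[ suc L ]) (j i : Fin (suc L)) → j Fin.< i →
            SameAlcove (reflectAlcove H (alc δ (suc j))) (alc δ (inject₁ j)) → pan δ i ⊆ InWall H →
            Σ (Gallery[ L ]) λ δ′ → SameAlcove (first δ′) (first δ) × last δ′ ≡ last δ
  shorten H δ zero    zero    ()
  shorten H δ (suc j) zero    ()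
  shorten {suc L} H δ zero (suc i) _ mirror p⊆H with reflectPrefix H (tail δ) i p⊆H
  ... | δ′ , first≡ , last≡ = δ′ , subst (λ c → SameAlcove c (first δ)) (sym first≡) mirror , last≡
  shorten {suc L} H δ (suc j) (suc i) (ℕ.s≤s j<i) mirror p⊆H with shorten H (tail δ) j i j<i mirror p⊆H
  ... | δ′ , first≈ , last≡ =
    cons (first δ) (pan δ zero) (wall δ zero) (isPanel δ zero) (inWall δ zero) (inPrev δ zero)
         δ′ (λ z z∈p → proj₂ first≈ z (inNext δ zero z z∈p)) , sameAlcove-refl {first δ} , last≡

  crossed-wall-not-revisited : ∀ {L} (δ : Gallery[ L ]) → IsMinimal δ → ∀ H (j i : Fin L) → j Fin.< i →
                               SameAlcove (reflectAlcove H (alc δ (suc j))) (alc δ (inject₁ j)) → pan δ i ⊆ InWall H → ⊥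
  crossed-wall-not-revisited {suc L} δ minimal H j i j<i mirror p⊆H with shorten H δ j i j<i mirror p⊆H
  ... | δ′ , first≈ , last≡ = ℕ.<-irrefl refl (minimal δ′ first≈ (subst (λ c → SameAlcove c (last δ)) (sym last≡) (sameAlcove-refl {last δ})))

  crossed-once : ∀ {L} (δ : Gallery[ L ]) → IsMinimal δ → ∀ s i → Crosses[ δ ] s → Crosses[ δ ] i →
                 SameWall (wall δ s) (wall δ i) → s ≡ i
  crossed-once δ minimal s i s-crosses i-crosses s≈i with Fin.<-cmp s i
  ... | tri< s<i _ _ = ⊥-elim (crossed-wall-not-revisited δ minimal (wall δ s) s i s<i (adjacent⇒mirror (stepPanel δ s) s-crosses)
                         (λ z z∈p → sameWall⇒⊆ {wall δ i} {wall δ s} (sameWall-sym {wall δ s} {wall δ i} s≈i) z (inWall δ i z z∈p)))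
  ... | tri≈ _ s≡i _ = s≡i
  ... | tri> _ _ i<s = ⊥-elim (crossed-wall-not-revisited δ minimal (wall δ i) i s i<s (adjacent⇒mirror (stepPanel δ i) i-crosses)
                         (λ z z∈p → sameWall⇒⊆ {wall δ s} {wall δ i} s≈i z (inWall δ s z z∈p)))

  preserved-along : ∀ {L} (Q : W → Set) (δ : Gallery[ L ]) → (∀ s → Q (alc δ (inject₁ s)) ⇔ Q (alc δ (suc s))) →
                    Q (first δ) ⇔ Q (last δ)
  preserved-along {zero}  Q δ step = ⇔.refl
  preserved-along {suc L} Q δ step = ⇔.trans (step zero) (preserved-along Q (tail δ) (step ∘ suc))

  preserved-except : ∀ {L} (Q : W → Set) (δ : Gallery[ L ]) i → (∀ s → s ≢ i → Q (alc δ (inject₁ s)) ⇔ Q (alc δ (suc s))) →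
                     (Q (first δ) ⇔ Q (alc δ (inject₁ i))) × (Q (alc δ (suc i)) ⇔ Q (last δ))
  preserved-except Q δ zero    step = ⇔.refl , preserved-along Q (tail δ) (λ s → step (suc s) λ ())
  preserved-except Q δ (suc i) step =
    let before , after = preserved-except Q (tail δ) i (λ s s≢i → step (suc s) (s≢i ∘ Fin.suc-injective))
    in ⇔.trans (step zero λ ()) before , after

  -- The crossing of a wall by a minimal gallery

  -- The alcove c lies on the side ⟨ · , α ⟩ ≥ k of H = H_{α,k}.
  Above : Wall → W → Set
  Above H c = height H ℤ.≤ level c (cls H)

  upward-step : ∀ {c c′ H′} H → SharedPanel c c′ H′ → ¬ Above H c → Above H c′ → SameWall H′ H × ¬ SameAlcove c c′
  upward-step {c} {c′} {H′} H@((h , h>0) , k) P c-below c′-above = (h′≡h , k′≡k) , c≉c′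
    where
    open SharedPanel P
    c≉c′ : ¬ SameAlcove c c′
    c≉c′ c≈c′ = c-below (subst (k ℤ.≤_) (sym (sameAlcove⇒level≡ {c} {c′} c≈c′ h)) c′-above)
    h′≡h : cls H′ ≡ h
    h′≡h = by-index (h Fin.≟ cls H′)
      where
      by-index : Dec (h ≡ cls H′) → cls H′ ≡ h
      by-index (yes h≡h′) = sym h≡h′
      by-index (no h≢h′)  = ⊥-elim (c-below (subst (k ℤ.≤_)
                              (sym (levels-agree-off-wall {c} {c′} {panel} {H′} ⊆ˡ ⊆ʳ unique h h>0 h≢h′)) c′-above))
    at-h : ∀ {d a} → level d (cls H′) ≡ a → level d h ≡ a
    at-h {d} = trans (cong (level d) (sym h′≡h))
    k′≡k : height H′ ≡ k
    k′≡k = by-direction (crossing-levels P c≉c′)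
      where
      by-direction : Up c c′ H′ ⊎ Down c c′ H′ → height H′ ≡ k
      by-direction (inj₁ (a≡k′-1 , a′≡k′)) = ℤ.≤-antisym
        (subst (ℤ._≤ k) (ℤ.suc-pred (height H′)) (ℤ.i<j⇒suc[i]≤j (subst (ℤ._< k) (at-h {c} a≡k′-1) (ℤ.≰⇒> c-below))))
        (subst (k ℤ.≤_) (at-h {c′} a′≡k′) c′-above)
      by-direction (inj₂ (a≡k′ , a′≡k′-1)) = ⊥-elim (c-below (subst (k ℤ.≤_) (sym (at-h {c} a≡k′))
        (ℤ.≤-trans (subst (k ℤ.≤_) (at-h {c′} a′≡k′-1) c′-above) (ℤ.<⇒≤ (pred[k]<k (height H′))))))

  same-side : ∀ {L} (δ : Gallery[ L ]) → IsMinimal δ → ∀ i → Crosses[ δ ] i →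
              ∀ s → s ≢ i → Above (wall δ i) (alc δ (inject₁ s)) ⇔ Above (wall δ i) (alc δ (suc s))
  same-side δ minimal i i-crosses s s≢i = mk⇔ upward downward
    where
    H = wall δ i
    c = alc δ (inject₁ s)
    c′ = alc δ (suc s)
    upward : Above H c → Above H c′
    upward c-above = decide (height H ℤ.≤? level c′ (cls H))
      where
      decide : Dec (Above H c′) → Above H c′
      decide (yes c′-above) = c′-above
      decide (no c′-below)  = let sw , c′≉c = upward-step H (swap (stepPanel δ s)) c′-below c-above
                              in ⊥-elim (s≢i (crossed-once δ minimal s i (c′≉c ∘ sameAlcove-sym {c} {c′}) i-crosses sw))
    downward : Above H c′ → Above H c
    downward c′-above = decide (height H ℤ.≤? level c (cls H))
      where
      decide : Dec (Above H c) → Above H c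
      decide (yes c-above) = c-above
      decide (no c-below)  = let sw , c≉c′ = upward-step H (stepPanel δ s) c-below c′-above
                             in ⊥-elim (s≢i (crossed-once δ minimal s i c≉c′ i-crosses sw))

  module _ {x y v} (x⊆C : InAlcove x ⊆ InLocalChamber (translation y) v) (h : Fin m) where
    private
      α = root h
      q = centre x
      z = proj₁ (x⊆C q (centre∈alcove x))
      ⟨q,α⟩ : ⟨ q , α ⟩ ≡ ℤ→ℚ (base y h) + ⟨ act₀ v z , α ⟩
      ⟨q,α⟩ = trans (cong ⟨_, α ⟩ (proj₂ (proj₂ (x⊆C q (centre∈alcove x)))))
                    (trans (⟨,⟩-⊕ˡ (translation y) (act₀ v z) α) (cong (_+ ⟨ act₀ v z , α ⟩) (⟨translation,root⟩ y h)))
      vz∈C : InChamber v (act₀ v z)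
      vz∈C = z , proj₁ (proj₂ (x⊆C q (centre∈alcove x))) , refl

    nonneg⇒base≤level : ChamberNonneg v α → base y h ℤ.≤ level x h
    nonneg⇒base≤level nonneg = <suc⇒≤ (ℤ→ℚ-cancel-< (≤-<-trans b≤⟨q,α⟩ (proj₂ (centre-strictStrip x h))))
      where
      b≤⟨q,α⟩ : ℤ→ℚ (base y h) ≤ ⟨ q , α ⟩
      b≤⟨q,α⟩ = subst (ℤ→ℚ (base y h) ≤_) (sym ⟨q,α⟩)
                  (subst (_≤ ℤ→ℚ (base y h) + ⟨ act₀ v z , α ⟩) (+-identityʳ _) (+-monoʳ-≤ (ℤ→ℚ (base y h)) (nonneg (act₀ v z) vz∈C)))

    nonpos⇒level<base : ChamberNonpos v α → level x h ℤ.< base y h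
    nonpos⇒level<base nonpos = ℤ→ℚ-cancel-< (<-≤-trans (proj₁ (centre-strictStrip x h)) ⟨q,α⟩≤b)
      where
      ⟨q,α⟩≤b : ⟨ q , α ⟩ ≤ ℤ→ℚ (base y h)
      ⟨q,α⟩≤b = subst (_≤ ℤ→ℚ (base y h)) (sym ⟨q,α⟩)
                  (subst (ℤ→ℚ (base y h) + ⟨ act₀ v z , α ⟩ ≤_) (+-identityʳ _) (+-monoʳ-≤ (ℤ→ℚ (base y h)) (nonpos (act₀ v z) vz∈C)))

  crossing-direction : ∀ {L} (δ : Gallery[ L ]) → IsMinimal δ → ∀ i → Crosses[ δ ] i →
                       ∀ y x v → SameAlcove (first δ) y → SameAlcove (last δ) x → InAlcove x ⊆ InLocalChamber (translation y) v →
                       let c = alc δ (inject₁ i) ; c′ = alc δ (suc i) ; H = wall δ i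
                       in StrictlyNonneg v (root (cls H)) × Up c c′ H ⊎ StrictlyNonpos v (root (cls H)) × Down c c′ H
  crossing-direction δ minimal i i-crosses y x v first≈y last≈x x⊆C =
    by-cases (chamber-side v h) (crossing-levels (stepPanel δ i) i-crosses)
    where
    H = wall δ i
    h = cls H
    k = height H
    c = alc δ (inject₁ i)
    c′ = alc δ (suc i)
    ends = preserved-except (Above H) δ i (same-side δ minimal i i-crosses)
    first≡y : level (first δ) h ≡ level y h
    first≡y = sameAlcove⇒level≡ {first δ} {y} first≈y h
    last≡x : level (last δ) h ≡ level x h
    last≡x = sameAlcove⇒level≡ {last δ} {x} last≈x h
    by-cases : StrictlyNonneg v (root h) ⊎ StrictlyNonpos v (root h) → Up c c′ H ⊎ Down c c′ H →
               StrictlyNonneg v (root h) × Up c c′ H ⊎ StrictlyNonpos v (root h) × Down c c′ H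
    by-cases (inj₁ v≥0) (inj₁ up)   = inj₁ (v≥0 , up)
    by-cases (inj₂ v≤0) (inj₂ down) = inj₂ (v≤0 , down)
    by-cases (inj₁ (nonneg , _)) (inj₂ (a≡k , a′≡k-1)) = ⊥-elim (ℤ.<⇒≱ (pred[k]<k k) (subst (k ℤ.≤_) a′≡k-1 c′-above))
      where
      first-above : k ℤ.≤ level (first δ) h
      first-above = Equivalence.from (proj₁ ends) (ℤ.≤-reflexive (sym a≡k))
      c′-above : Above H c′
      c′-above = Equivalence.from (proj₂ ends) (subst (k ℤ.≤_) (sym last≡x)
        (ℤ.≤-trans (subst (k ℤ.≤_) first≡y first-above)
          (ℤ.≤-trans (proj₁ (level≤base≤suc[level] y h)) (nonneg⇒base≤level {x} {y} {v} x⊆C h nonneg))))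
    by-cases (inj₂ (nonpos , _)) (inj₁ (a≡k-1 , a′≡k)) = ⊥-elim (ℤ.<⇒≱ (pred[k]<k k) (subst (k ℤ.≤_) a≡k-1 c-above))
      where
      last-above : k ℤ.≤ level (last δ) h
      last-above = Equivalence.to (proj₂ ends) (ℤ.≤-reflexive (sym a′≡k))
      x≤y : level x h ℤ.≤ level y h
      x≤y = <suc⇒≤ (ℤ.<-≤-trans (nonpos⇒level<base {x} {y} {v} x⊆C h nonpos) (proj₂ (level≤base≤suc[level] y h)))
      c-above : Above H c
      c-above = Equivalence.to (proj₁ ends) (subst (k ℤ.≤_) (sym first≡y) (ℤ.≤-trans (subst (k ℤ.≤_) last≡x last-above) x≤y))

  φ+-at-k : ∀ {w c} H → level c (cls H) ≡ height H → ChamberNonneg w (root (cls H)) → φ+ w H c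
  φ+-at-k {c = c} ((h , _) , k) a≡k nonneg z z∈c =
    (λ _ → subst (_≤ ⟨ z , root h ⟩) (cong ℤ→ℚ a≡k) (proj₁ (alcove⇒strip {c} z∈c h))) , (λ ¬nonneg → ⊥-elim (¬nonneg nonneg))

  φ+-at-k-1 : ∀ {w c} H → level c (cls H) ≡ ℤ.pred (height H) → ¬ ChamberNonneg w (root (cls H)) → φ+ w H c
  φ+-at-k-1 {c = c} ((h , _) , k) a≡k-1 ¬nonneg z z∈c =
    (λ nonneg → ⊥-elim (¬nonneg nonneg)) ,
    (λ _ → subst (⟨ z , root h ⟩ ≤_) (trans (cong (ℤ→ℚ ∘ ℤ.suc) a≡k-1) (ℤ→ℚ-suc-pred k)) (proj₂ (alcove⇒strip {c} z∈c h)))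

  ¬φ+-at-k : ∀ {w c} H → level c (cls H) ≡ height H → ¬ ChamberNonneg w (root (cls H)) → ¬ φ+ w H c
  ¬φ+-at-k {c = c} ((h , _) , k) a≡k ¬nonneg φ⁺ =
    <-irrefl refl (<-≤-trans (subst (_< ⟨ centre c , root h ⟩) (cong ℤ→ℚ a≡k) (proj₁ (centre-strictStrip c h)))
                             (proj₂ (φ⁺ (centre c) (centre∈alcove c)) ¬nonneg))

  ¬φ+-at-k-1 : ∀ {w c} H → level c (cls H) ≡ ℤ.pred (height H) → ChamberNonneg w (root (cls H)) → ¬ φ+ w H c
  ¬φ+-at-k-1 {c = c} ((h , _) , k) a≡k-1 nonneg φ⁺ =
    <-irrefl refl (≤-<-trans (proj₁ (φ⁺ (centre c) (centre∈alcove c)) nonneg)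
                             (subst (⟨ centre c , root h ⟩ <_) (trans (cong (ℤ→ℚ ∘ ℤ.suc) a≡k-1) (ℤ→ℚ-suc-pred k))
                               (proj₂ (centre-strictStrip c h))))

  positiveCrossing⇔differentSides : ∀ v w H c c′ →
    StrictlyNonneg v (root (cls H)) × Up c c′ H ⊎ StrictlyNonpos v (root (cls H)) × Down c c′ H →
    StrictlyNonneg w (root (cls H)) ⊎ StrictlyNonpos w (root (cls H)) →
    (φ+ w H c × ¬ φ+ w H c′) ⇔ DifferentSides v w (root (cls H))
  positiveCrossing⇔differentSides v w H c c′ (inj₁ ((_ , ¬v≤0) , a≡k-1 , _)) (inj₁ (w≥0 , ¬w≤0)) =
    mk⇔ (λ (φc , _) → ⊥-elim (¬φ+-at-k-1 {w} {c} H a≡k-1 w≥0 φc))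
        (λ { (inj₁ (_ , v≤0)) → ⊥-elim (¬v≤0 v≤0) ; (inj₂ (w≤0 , _)) → ⊥-elim (¬w≤0 w≤0) })
  positiveCrossing⇔differentSides v w H c c′ (inj₁ ((v≥0 , _) , a≡k-1 , a′≡k)) (inj₂ (w≤0 , ¬w≥0)) =
    mk⇔ (λ _ → inj₂ (w≤0 , v≥0)) (λ _ → φ+-at-k-1 {w} {c} H a≡k-1 ¬w≥0 , ¬φ+-at-k {w} {c′} H a′≡k ¬w≥0)
  positiveCrossing⇔differentSides v w H c c′ (inj₂ ((v≤0 , _) , a≡k , a′≡k-1)) (inj₁ (w≥0 , _)) =
    mk⇔ (λ _ → inj₁ (w≥0 , v≤0)) (λ _ → φ+-at-k {w} {c} H a≡k w≥0 , ¬φ+-at-k-1 {w} {c′} H a′≡k-1 w≥0)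
  positiveCrossing⇔differentSides v w H c c′ (inj₂ ((_ , ¬v≥0) , a≡k , _)) (inj₂ (_ , ¬w≥0)) =
    mk⇔ (λ (φc , _) → ⊥-elim (¬φ+-at-k {w} {c} H a≡k ¬w≥0 φc))
        (λ { (inj₁ (w≥0 , _)) → ⊥-elim (¬w≥0 w≥0) ; (inj₂ (_ , v≥0)) → ⊥-elim (¬v≥0 v≥0) })

corollary3p7 : ∀ {n} (R : RootSystem n) → let open RootSystem R in
    (w u v : W₀) (μ : V n) (μ∈R∨ : InCorootLattice μ) (x : W) →
    InAlcove x ⊆ InLocalChamber μ v →
    (γ : Gallery) →
    SameAlcove (start γ) (t^ μ [ μ∈R∨ ] u) → SameAlcove (end γ) x → Minimal γ →
    (i : Fin (len γ)) → Crosses γ i →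
    PositiveCrossing w γ i ⇔ DifferentSides v w (root (cls (wall γ i)))
corollary3p7 R w u v μ μ∈R∨ x x⊆C γ start≈y end≈x minimal i i-crosses =
  positiveCrossing⇔differentSides R v w (wall γ i) (alc γ (inject₁ i)) (alc γ (suc i))
    (crossing-direction R (fromGallery R γ) (minimal⇒isMinimal R {γ} minimal) i i-crosses (t^ μ [ μ∈R∨ ] u) x v start≈y end≈x x⊆C)
    (chamber-side R w (cls (wall γ i)))
  where open RootSystem R
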